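{- Let $A$ be a regular system of divisors, $f:\mathbb N\to\mathbb C$ an arbitrary function, $n\in\mathbb N$, and let $\chi$ be a Dirichlet character modulo $n$ with conductor $d$ (so $d\mid n$). Then \[ \sum_{j=1}^n f\big((j-1,n)_A\big)\chi(j)=\varphi(n)\sum_{\substack{\delta\in\mathbb N\\ d\delta\in A(n)}}\frac{(\mu_A*_Af)(d\delta)}{\varphi(d\delta)}, \] where $\varphi$ is Euler's function. In particular, if $\chi$ is a primitive character modulo $n$, then \[ \sum_{j=1}^n f\big((j-1,n)_A\big)\chi(j)=(\mu_A*_Af)(n). \]
   Context: A regular system of divisors is a family $A=(A(n))_{n\in\mathbb N}$, where each $A(n)$ is a set of positive divisors of $n$, such that: (i) $A(1)=\{1\}$ and $A(mn)=\{de: d\in A(m), e\in A(n)\}$ whenever $\gcd(m,n)=1$; (ii) for every prime power $p^a$ ($a\ge1$) there is a divisor $t=t_A(p^a)$ of $a$ such that $A(p^{it})=\{1,p^t,\dots,p^{it}\}$ for every $0\le i\le a/t$. The $A$-convolution of $f,g:\mathbb N\to\mathbb C$ is $(f*_Ag)(n)=\sum_{d\in A(n)}f(d)g(n/d)$; $\mu_A$ is the $*_A$-inverse of the constant function $1$. For $j\in\mathbb Z$ (including $j=0$), $(j,n)_A=\max\{d\in\mathbb N: d\mid j,\ d\in A(n)\}$. -}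

module Defs where

open import Level using (Level) renaming (_⊔_ to _⊔ˡ_)
open import Data.Bool using (Bool; true; false; if_then_else_)
open import Data.Nat as ℕ using (ℕ; zero; suc; _*_; _^_; _≤_; _<_; _⊔_)
open import Data.Nat.Divisibility using (_∣_; _∣?_)
open import Data.Nat.DivMod using (_/_)
open import Data.Nat.GCD using (gcd)
open import Data.Nat.Primality using (Prime)
open import Data.List using (List; []; _∷_; foldr; map; filter; length)
open import Data.Product using (Σ; _×_; _,_; ∃-syntax)
open import Relation.Nullary using (¬_; Dec; yes; no)
open import Relation.Nullary.Decidable using (⌊_⌋)
open import Relation.Binary.PropositionalEquality using (_≡_)
open import Algebra.Bundles using (CommutativeRing)
open import Function.Bundles using (_⇔_)

range1 : ℕ → List ℕ
range1 zero    = []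
range1 (suc n) = Data.List._++_ (range1 n) (suc n ∷ [])

-- A system of divisors is given by its membership predicate:
-- A n d ≡ true  means  d ∈ A(n).  (Each A(n), n ≥ 1, is a finite set, so
-- a Bool-valued membership function is the same as a subset.)

_∈A_ : (ℕ → ℕ → Bool) → ℕ × ℕ → Set
A ∈A (n , d) = A n d ≡ true

record IsRegularSystem (A : ℕ → ℕ → Bool) : Set where
  field
    divisor   : ∀ n d → 1 ≤ n → A n d ≡ true → 1 ≤ d × d ∣ n
    one       : ∀ d → (A 1 d ≡ true) ⇔ (d ≡ 1)
    mult      : ∀ m n → 1 ≤ m → 1 ≤ n → gcd m n ≡ 1 → ∀ k →
                (A (m * n) k ≡ true) ⇔
                (∃[ d ] ∃[ e ] (A m d ≡ true × A n e ≡ true × k ≡ d * e))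
    primePow  : ∀ p a → Prime p → 1 ≤ a →
                ∃[ t ] (t ∣ a × (∀ i → i * t ≤ a → ∀ k →
                  (A (p ^ (i * t)) k ≡ true) ⇔ (∃[ j ] (j ≤ i × k ≡ p ^ (j * t)))))

elemsA : (ℕ → ℕ → Bool) → ℕ → List ℕ
elemsA A n = filter (λ d → A n d Data.Bool.≟ true) (range1 n)

-- (j, n)_A = max { d : d ∣ j, d ∈ A(n) }   (for n ≥ 1; note j = 0 allowed)
gcdA : (ℕ → ℕ → Bool) → ℕ → ℕ → ℕ
gcdA A j n = foldr _⊔_ 0 (filter (λ d → d ∣? j) (elemsA A n))

-- exact quotient n / d for d ≥ 1 (only used with d ∣ n, d ≥ 1)
quot : ℕ → ℕ → ℕ
quot n zero    = 0
quot n (suc k) = n / suc k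

φ : ℕ → ℕ
φ n = length (filter (λ k → gcd k n ℕ.≟ 1) (range1 n))

-- A field of characteristic zero (stand-in for ℂ).
-- Ring operations are renamed with a superscript K to avoid clashes with ℕ.
module RingNat {c ℓ} (R : CommutativeRing c ℓ) where
  open CommutativeRing R
  ι : ℕ → Carrier
  ι zero    = 0#
  ι (suc m) = 1# + ι m

record Char0Field (c ℓ : Level) : Set (Level.suc (c ⊔ˡ ℓ)) where
  field
    cring : CommutativeRing c ℓ
  open CommutativeRing cring public
    renaming (_+_ to _+ᴷ_; _*_ to _*ᴷ_; 0# to 0ᴷ; 1# to 1ᴷ; -_ to -ᴷ_)
  open RingNat cring public
  field
    _⁻¹      : Carrier → Carrier
    inverseʳ : ∀ x → ¬ (x ≈ 0ᴷ) → (x *ᴷ (x ⁻¹)) ≈ 1ᴷ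
    char0    : ∀ m → ι m ≈ 0ᴷ → m ≡ 0
  sumK : List ℕ → (ℕ → Carrier) → Carrier
  sumK xs g = foldr (λ x acc → g x +ᴷ acc) 0ᴷ xs

module _ {c ℓ} (K : Char0Field c ℓ) where
  open Char0Field K

  convA : (ℕ → ℕ → Bool) → (ℕ → Carrier) → (ℕ → Carrier) → ℕ → Carrier
  convA A f g n = sumK (elemsA A n) (λ d → f d *ᴷ g (quot n d))

  -- μ is the *_A-inverse of the constant function 1 (on ℕ = {1,2,…}):
  -- (μ *_A 1)(n) = [n = 1] for all n ≥ 1
  IsMobiusA : (ℕ → ℕ → Bool) → (ℕ → Carrier) → Set ℓ
  IsMobiusA A μ = ∀ n → 1 ≤ n →
    convA A μ (λ _ → 1ᴷ) n ≈ (if ⌊ n ℕ.≟ 1 ⌋ then 1ᴷ else 0ᴷ)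

  record IsDirichletChar (n : ℕ) (χ : ℕ → Carrier) : Set (c ⊔ˡ ℓ) where
    field
      one      : χ 1 ≈ 1ᴷ
      mult     : ∀ a b → χ (a * b) ≈ (χ a *ᴷ χ b)
      periodic : ∀ a → χ (a ℕ.+ n) ≈ χ a
      zero⇔    : ∀ a → (χ a ≈ 0ᴷ) ⇔ (¬ (gcd a n ≡ 1))

  -- χ is induced by a character modulo d  (d ∣ n):  χ(a) = 1 whenever
  -- gcd(a,n) = 1 and a ≡ 1 (mod d)
  InducedMod : ℕ → (ℕ → Carrier) → ℕ → Set ℓ
  InducedMod n χ d = ∀ a → gcd a n ≡ 1 → d ∣ (a ℕ.∸ 1) → χ a ≈ 1ᴷ

  IsConductor : ℕ → (ℕ → Carrier) → ℕ → Set ℓ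
  IsConductor n χ d = 1 ≤ d × d ∣ n × InducedMod n χ d ×
                      (∀ e → 1 ≤ e → e ∣ n → InducedMod n χ e → d ≤ e)

-- Expanding f = (μ_A *_A f) *_A 1 and noting that the A-divisors of (j - 1, n)_A are
-- the e ∈ A(n) dividing j - 1 turns the sum into Σ_{e ∈ A(n)} (μ_A *_A f)(e) S(e),
-- where S(e) is the sum of χ(j) over j ≤ n with j ≡ 1 (mod e). If the conductor d
-- divides e, χ is 1 on the units counted by S(e), which number φ(n)/φ(e). If not,
-- S(e) = 0: multiplying by a unit b ≡ 1 (mod e) permutes these j, so S(e) ≠ 0 would
-- force χ(b) = 1, i.e. χ would be induced modulo e; the moduli inducing χ are closed
-- under gcd, contradicting the minimality of d.

module Submission where

open import Defs
open import Data.Bool using (Bool; true)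
open import Data.Nat using (ℕ; _*_; _∸_; _≤_; suc)
open import Data.List using (filter)
open import Data.Product using (_×_; _,_)

module Arithmetic where

  open import Data.Nat as ℕ using (ℕ; zero; suc; _+_; _*_; _∸_; _≤_; _<_; z≤n; s≤s; _%_; _/_; NonZero)
  import Data.Nat.Properties as NP
  open import Data.Nat.Divisibility
  open import Data.Nat.DivMod
  open import Data.Nat.GCD
  open import Data.Nat.Coprimality as Coprime
    using (Coprime; coprime-divisor; gcd≡1⇒coprime)
  open import Data.Nat.Tactic.RingSolver using (solve-∀)
  open import Data.Product using (_×_; _,_; ∃-syntax)
  open import Relation.Nullary using (yes; no)
  open import Relation.Binary.PropositionalEquality
  open import Data.Empty using (⊥-elim)
  open import Data.Sum using (inj₁; inj₂)
  open import Relation.Unary using (Decidable)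
  open import Function using (_∘_)
  open ≡-Reasoning

  quot-correct : ∀ {n d} → 1 ≤ d → d ∣ n → n ≡ d * quot n d
  quot-correct {d = suc _} _ d∣n = sym (m*[n/m]≡n d∣n)

  quot-cancelˡ : ∀ d q → 1 ≤ d → quot (d * q) d ≡ q
  quot-cancelˡ (suc d) q _ = trans (cong (_/ suc d) (NP.*-comm (suc d) q)) (m*n/n≡m q (suc d))

  positive-factor : ∀ {m} x y → 1 ≤ m → m ≡ x * y → 1 ≤ y
  positive-factor x zero m≥1 e = ⊥-elim (NP.<⇒≢ m≥1 (sym (trans e (NP.*-zeroʳ x))))
  positive-factor x (suc y) _ _ = s≤s z≤n

  quot-∣ : ∀ {n d} → 1 ≤ n → 1 ≤ d → d ∣ n → 1 ≤ quot n d × quot n d ∣ n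
  quot-∣ {n} {d} n≥1 d≥1 d∣n = positive-factor d (quot n d) n≥1 n≡ , divides d n≡
    where n≡ = quot-correct d≥1 d∣n

  private
    interchange : ∀ a b c d → a * b * (c * d) ≡ a * c * (b * d)
    interchange = solve-∀

  quot-* : ∀ {q r d e} → 1 ≤ d → 1 ≤ e → d ∣ q → e ∣ r →
           quot (q * r) (d * e) ≡ quot q d * quot r e
  quot-* {q} {r} {d} {e} d≥1 e≥1 d∣q e∣r = begin
    quot (q * r) (d * e)
      ≡⟨ cong (λ m → quot m (d * e)) (cong₂ _*_ (quot-correct d≥1 d∣q) (quot-correct e≥1 e∣r)) ⟩
    quot (d * quot q d * (e * quot r e)) (d * e)
      ≡⟨ cong (λ m → quot m (d * e)) (interchange d (quot q d) e (quot r e)) ⟩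
    quot (d * e * (quot q d * quot r e)) (d * e)
      ≡⟨ quot-cancelˡ (d * e) _ (NP.*-mono-≤ d≥1 e≥1) ⟩
    quot q d * quot r e ∎

  largest-≤ : ∀ {p} (P : ℕ → Set p) → Decidable P → P 0 →
              ∀ i → ∃[ b ] (b ≤ i × P b × (∀ j → j ≤ i → P j → j ≤ b))
  largest-≤ P P? P0 zero = 0 , z≤n , P0 , λ { .zero z≤n _ → z≤n }
  largest-≤ P P? P0 (suc i) with P? (suc i) | largest-≤ P P? P0 i
  ... | yes P[1+i] | _ = suc i , NP.≤-refl , P[1+i] , λ _ j≤1+i _ → j≤1+i
  ... | no ¬P[1+i] | b , b≤i , Pb , maximal = b , NP.m≤n⇒m≤1+n b≤i , Pb , maximal′
    where
      maximal′ : ∀ j → j ≤ suc i → P j → j ≤ b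
      maximal′ j j≤1+i Pj with NP.m≤n⇒m<n∨m≡n j≤1+i
      ... | inj₁ (s≤s j≤i) = maximal j j≤i Pj
      ... | inj₂ refl      = ⊥-elim (¬P[1+i] Pj)

  coprime-divisorʳ : ∀ {m n o} → Coprime m o → m ∣ n * o → m ∣ n
  coprime-divisorʳ {m} {n} {o} c m∣no = coprime-divisor c (subst (m ∣_) (NP.*-comm n o) m∣no)

  coprime-∣ˡ : ∀ {d a n} → d ∣ a → Coprime a n → Coprime d n
  coprime-∣ˡ d∣a ca (x∣d , x∣n) = ca (∣-trans x∣d d∣a , x∣n)

  coprime-∣ʳ : ∀ {d a n} → d ∣ n → Coprime a n → Coprime a d
  coprime-∣ʳ d∣n ca (x∣a , x∣d) = ca (x∣a , ∣-trans x∣d d∣n)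

  coprime-*ˡ : ∀ {a b n} → Coprime a n → Coprime b n → Coprime (a * b) n
  coprime-*ˡ ca cb (d∣ab , d∣n) = cb (coprime-divisor (Coprime.sym (coprime-∣ʳ d∣n ca)) d∣ab , d∣n)

  coprime-∣∣ : ∀ {q r d e} → Coprime q r → d ∣ q → e ∣ r → Coprime d e
  coprime-∣∣ c d∣q e∣r = coprime-∣ˡ d∣q (coprime-∣ʳ e∣r c)

  coprime-%⁺ : ∀ x n .{{_ : NonZero n}} → Coprime x n → Coprime (x % n) n
  coprime-%⁺ x n cx (c∣ , c∣n) = cx (∣n∣m%n⇒∣m c∣n c∣ , c∣n)

  coprime-%⁻ : ∀ x n .{{_ : NonZero n}} → Coprime (x % n) n → Coprime x n
  coprime-%⁻ x n cx (c∣ , c∣n) = cx (%-presˡ-∣ c∣ c∣n , c∣n)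

  coprime-%-cong : ∀ {x y} n .{{_ : NonZero n}} → x % n ≡ y % n → Coprime x n → Coprime y n
  coprime-%-cong {x} {y} n x≡y cx = coprime-%⁻ y n (subst (λ z → Coprime z n) x≡y (coprime-%⁺ x n cx))

  coprime⇒∣* : ∀ {x y k} → Coprime x y → x ∣ k → y ∣ k → x * y ∣ k
  coprime⇒∣* {x} {y} cxy (divides u refl) y∣k
    with coprime-divisor (Coprime.sym cxy) (subst (y ∣_) (NP.*-comm u x) y∣k)
  ... | divides w refl = divides w (trans (NP.*-assoc w y x) (cong (w *_) (NP.*-comm y x)))

  -- The largest divisor of b coprime to r, found by repeatedly dividing out gcd b r.
  module CoprimePart (r : ℕ) where

    strip : ℕ → ℕ → ℕ
    strip zero b = b
    strip (suc fuel) b with gcd b r ℕ.≟ 1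
    ... | yes _ = b
    ... | no _  = strip fuel (quot b (gcd b r))

    coprimePart : ℕ → ℕ
    coprimePart b = strip b b

    private
      strip-coprime : ∀ fuel b → 1 ≤ b → b ≤ fuel → Coprime (strip fuel b) r
      strip-coprime zero b b≥1 b≤0 = ⊥-elim (NP.<⇒≱ b≥1 b≤0)
      strip-coprime (suc fuel) b b≥1 b≤fuel with gcd b r ℕ.≟ 1
      ... | yes g≡1 = gcd≡1⇒coprime g≡1
      ... | no g≢1  = strip-coprime fuel b′ b′≥1 (NP.≤-pred (NP.≤-trans b′<b b≤fuel))
        where
          g  = gcd b r
          b′ = quot b g
          g>1 : 1 < g
          g>1 = NP.≤∧≢⇒< (NP.n≢0⇒n>0 (λ g≡0 → NP.<⇒≢ b≥1 (sym (gcd[m,n]≡0⇒m≡0 g≡0)))) (g≢1 ∘ sym)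
          b≡ : b ≡ g * b′
          b≡ = quot-correct (NP.<⇒≤ g>1) (gcd[m,n]∣m b r)
          b′≥1 : 1 ≤ b′
          b′≥1 = positive-factor g b′ b≥1 b≡
          b′<b : b′ < b
          b′<b = subst (b′ <_) (trans (NP.*-comm b′ g) (sym b≡)) (NP.m<m*n b′ g {{ℕ.>-nonZero b′≥1}} g>1)

      strip-∣ : ∀ fuel b c → c ∣ b → Coprime c r → c ∣ strip fuel b
      strip-∣ zero b c c∣b cr = c∣b
      strip-∣ (suc fuel) b c c∣b cr with gcd b r ℕ.≟ 1
      ... | yes _ = c∣b
      ... | no _ with gcd b r ℕ.≟ 0
      ...   | yes g≡0 = strip-∣ fuel _ c (subst (c ∣_) b≡ c∣b) cr
        where b≡ : b ≡ quot b (gcd b r)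
              b≡ = trans (gcd[m,n]≡0⇒m≡0 g≡0) (sym (cong (quot b) g≡0))
      ...   | no g≢0 = strip-∣ fuel _ c (coprime-divisor (coprime-∣ʳ (gcd[m,n]∣n b r) cr) c∣gb′) cr
        where c∣gb′ = subst (c ∣_) (quot-correct (NP.n≢0⇒n>0 g≢0) (gcd[m,n]∣m b r)) c∣b

    coprimePart-coprime : ∀ b → 1 ≤ b → Coprime (coprimePart b) r
    coprimePart-coprime b b≥1 = strip-coprime b b b≥1 NP.≤-refl

    coprime⇒∣coprimePart : ∀ {b c} → c ∣ b → Coprime c r → c ∣ coprimePart b
    coprime⇒∣coprimePart {b} {c} = strip-∣ b b c

  -- Every residue r coprime to M has a representative r + M t coprime to n:
  -- take t to be the part of n coprime to r.
  coprime-representative : ∀ M n r → Coprime r M → 1 ≤ n → ∃[ t ] Coprime (r + M * t) n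
  coprime-representative M n r crM n≥1 = t , λ (c∣x , c∣n) → coprime-cr c∣x (∣-refl , c∣r c∣x c∣n)
    where
      open CoprimePart r
      t = coprimePart n
      coprime-cr : ∀ {c} → c ∣ r + M * t → Coprime c r
      coprime-cr {c} c∣x = gcd≡1⇒coprime (coprimePart-coprime n n≥1 (q∣t , q∣r))
        where
          q∣r = gcd[m,n]∣n c r
          q∣t = coprime-divisor (coprime-∣ˡ q∣r crM) (∣m+n∣m⇒∣n (∣-trans (gcd[m,n]∣m c r) c∣x) q∣r)
      c∣r : ∀ {c} → c ∣ r + M * t → c ∣ n → c ∣ r
      c∣r {c} c∣x c∣n = ∣m+n∣m⇒∣n (subst (c ∣_) (NP.+-comm r (M * t)) c∣x)
                                 (∣n⇒∣m*n M (coprime⇒∣coprimePart c∣n (coprime-cr c∣x)))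

  *-congˡ-% : ∀ {x y} z n .{{_ : NonZero n}} → x % n ≡ y % n → (z * x) % n ≡ (z * y) % n
  *-congˡ-% {x} {y} z n x≡y = begin
    (z * x) % n           ≡⟨ %-distribˡ-* z x n ⟩
    (z % n * (x % n)) % n ≡⟨ cong (λ u → (z % n * u) % n) x≡y ⟩
    (z % n * (y % n)) % n ≡⟨ %-distribˡ-* z y n ⟨
    (z * y) % n           ∎

  *-congʳ-% : ∀ {x y} z n .{{_ : NonZero n}} → x % n ≡ y % n → (x * z) % n ≡ (y * z) % n
  *-congʳ-% {x} {y} z n x≡y = begin
    (x * z) % n ≡⟨ cong (_% n) (NP.*-comm x z) ⟩
    (z * x) % n ≡⟨ *-congˡ-% z n x≡y ⟩
    (z * y) % n ≡⟨ cong (_% n) (NP.*-comm z y) ⟩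
    (y * z) % n ∎

  +-*-% : ∀ r e t .{{_ : NonZero e}} → (r + e * t) % e ≡ r % e
  +-*-% r e t = trans (cong (λ z → (r + z) % e) (NP.*-comm e t)) ([m+kn]%n≡m%n r t e)

  -- j ≡ 1 (mod e) in the form used by InducedMod; note 0 ∸ 1 = 0
  %≡1⇒∣∸1 : ∀ e .{{_ : NonZero e}} j → j % e ≡ 1 % e → e ∣ j ∸ 1
  %≡1⇒∣∸1 e zero _ = e ∣0
  %≡1⇒∣∸1 e (suc j) j≡1 = divides (suc j / e ∸ 1 / e) (begin
    suc j ∸ 1                                   ≡⟨ cong₂ _∸_ (m≡m%n+[m/n]*n (suc j) e) (m≡m%n+[m/n]*n 1 e) ⟩
    (suc j % e + suc j / e * e) ∸ (1 % e + 1 / e * e) ≡⟨ cong (λ u → (u + suc j / e * e) ∸ (1 % e + 1 / e * e)) j≡1 ⟩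
    (1 % e + suc j / e * e) ∸ (1 % e + 1 / e * e)     ≡⟨ NP.[m+n]∸[m+o]≡n∸o (1 % e) _ _ ⟩
    suc j / e * e ∸ 1 / e * e                   ≡⟨ NP.*-distribʳ-∸ e (suc j / e) (1 / e) ⟨
    (suc j / e ∸ 1 / e) * e                     ∎)

  ∣∸1⇒%≡1 : ∀ e .{{_ : NonZero e}} j → 1 ≤ j → e ∣ j ∸ 1 → j % e ≡ 1 % e
  ∣∸1⇒%≡1 e j j≥1 e∣ = trans (cong (_% e) (sym (NP.m+[n∸m]≡n j≥1))) (%-remove-+ʳ 1 e∣)

  ∣∸1-%-cong : ∀ e .{{_ : NonZero e}} {x y} → 1 ≤ x → x % e ≡ y % e → e ∣ x ∸ 1 → e ∣ y ∸ 1
  ∣∸1-%-cong e {x} {y} x≥1 x≡y e∣ = %≡1⇒∣∸1 e y (trans (sym x≡y) (∣∸1⇒%≡1 e x x≥1 e∣))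

  residue : (n : ℕ) → .{{NonZero n}} → ℕ → ℕ
  residue (suc n) x = suc ((x + n) % suc n)

  residue-range : ∀ n .{{_ : NonZero n}} x → 1 ≤ residue n x × residue n x ≤ n
  residue-range (suc n) x = s≤s z≤n , m%n<n (x + n) (suc n)

  residue-% : ∀ n .{{_ : NonZero n}} x → residue n x % n ≡ x % n
  residue-% (suc n) x = begin
    (1 + y) % m                ≡⟨ %-distribˡ-+ 1 y m ⟩
    (1 % m + y % m) % m        ≡⟨ cong (λ u → (1 % m + u) % m) (m%n%n≡m%n (x + n) m) ⟩
    (1 % m + (x + n) % m) % m  ≡⟨ %-distribˡ-+ 1 (x + n) m ⟨
    (1 + (x + n)) % m          ≡⟨ cong (_% m) (trans (cong suc (NP.+-comm x n)) (sym (NP.+-comm x m))) ⟩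
    (x + m) % m                ≡⟨ [m+n]%n≡m%n x m ⟩
    x % m                      ∎
    where m = suc n
          y = (x + n) % m

  residue-id : ∀ n .{{_ : NonZero n}} x → 1 ≤ x → x ≤ n → residue n x ≡ x
  residue-id (suc n) (suc x) _ (s≤s x≤n) =
    cong suc (trans (cong (_% suc n) (sym (NP.+-suc x n)))
             (trans ([m+n]%n≡m%n x (suc n)) (m≤n⇒m%n≡m x≤n)))

  residue-cong : ∀ n .{{_ : NonZero n}} {x y} → x % n ≡ y % n → residue n x ≡ residue n y
  residue-cong (suc n) {x} {y} x≡y = cong suc (begin
    (x + n) % suc n                    ≡⟨ %-distribˡ-+ x n (suc n) ⟩
    (x % suc n + n % suc n) % suc n    ≡⟨ cong (λ u → (u + n % suc n) % suc n) x≡y ⟩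
    (y % suc n + n % suc n) % suc n    ≡⟨ %-distribˡ-+ y n (suc n) ⟨
    (y + n) % suc n                    ∎)

  %-injective : ∀ n .{{_ : NonZero n}} {x y} → 1 ≤ x → x ≤ n → 1 ≤ y → y ≤ n → x % n ≡ y % n → x ≡ y
  %-injective n {x} {y} x≥1 x≤n y≥1 y≤n x≡y =
    trans (sym (residue-id n x x≥1 x≤n)) (trans (residue-cong n x≡y) (residue-id n y y≥1 y≤n))

  private
    inverse-identity : ∀ a x y n → 1 + x * a ≡ y * suc n → a * (x * n) + suc n ≡ 1 + (y * n) * suc n
    inverse-identity a x y n h = begin
      a * (x * n) + suc n     ≡⟨ lemma₁ a x n ⟩
      (1 + x * a) * n + 1     ≡⟨ cong (λ u → u * n + 1) h ⟩
      y * suc n * n + 1       ≡⟨ lemma₂ y n ⟩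
      1 + (y * n) * suc n     ∎
      where
        lemma₁ : ∀ a x n → a * (x * n) + suc n ≡ (1 + x * a) * n + 1
        lemma₁ = solve-∀
        lemma₂ : ∀ y n → y * suc n * n + 1 ≡ 1 + (y * n) * suc n
        lemma₂ = solve-∀

  mod-inverse : ∀ a n .{{_ : NonZero n}} → Coprime a n → ∃[ a′ ] (a * a′) % n ≡ 1 % n
  mod-inverse a (suc n) ca with Coprime.coprime-Bézout ca
  ... | Bézout.+- x y eq =
    x , trans (cong (_% suc n) (trans (NP.*-comm a x) (sym eq))) ([m+kn]%n≡m%n 1 y (suc n))
  ... | Bézout.-+ x y eq = x * n , (begin
    (a * (x * n)) % suc n                   ≡⟨ [m+n]%n≡m%n (a * (x * n)) (suc n) ⟨
    (a * (x * n) + suc n) % suc n           ≡⟨ cong (_% suc n) (inverse-identity a x y n eq) ⟩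
    (1 + (y * n) * suc n) % suc n           ≡⟨ [m+kn]%n≡m%n 1 (y * n) (suc n) ⟩
    1 % suc n                               ∎)

  inverse-cancelˡ : ∀ u u′ n .{{_ : NonZero n}} → (u * u′) % n ≡ 1 % n → ∀ x → (u′ * (u * x)) % n ≡ x % n
  inverse-cancelˡ u u′ n uu′ x = begin
    (u′ * (u * x)) % n ≡⟨ cong (_% n) (NP.*-assoc u′ u x) ⟨
    (u′ * u * x) % n   ≡⟨ *-congʳ-% x n (trans (cong (_% n) (NP.*-comm u′ u)) uu′) ⟩
    (1 * x) % n        ≡⟨ cong (_% n) (NP.*-identityˡ x) ⟩
    x % n              ∎

  inverse-coprime : ∀ x {x′} n .{{_ : NonZero n}} → (x * x′) % n ≡ 1 % n → Coprime x′ n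
  inverse-coprime x n xx′ (c∣x′ , c∣n) =
    ∣1⇒≡1 (∣n∣m%n⇒∣m c∣n (subst (_ ∣_) xx′ (%-presˡ-∣ (∣n⇒∣m*n x c∣x′) c∣n)))

module PrimePowers where

  open Arithmetic using (positive-factor; coprime-*ˡ)
  open import Data.Nat as ℕ using (ℕ; zero; suc; _*_; _^_; _≤_; _<_; z≤n; s≤s)
  import Data.Nat.Properties as NP
  open import Data.Nat.Divisibility
  open import Data.Nat.GCD using (gcd)
  open import Data.Nat.Coprimality using (Coprime; coprime⇒gcd≡1; 1-coprimeTo)
  open import Data.Nat.Primality
  open import Data.Nat.Primality.Factorisation using (factorise)
  open import Data.Nat.Induction using (<-rec)
  open import Data.Nat.ListAction using (product)
  open import Data.List using ([]; _∷_)
  open import Data.List.Relation.Unary.All using (_∷_)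
  open import Data.Product using (_×_; _,_; ∃-syntax)
  open import Data.Sum using (inj₁; inj₂)
  open import Data.Empty using (⊥-elim)
  open import Relation.Nullary using (¬_; yes; no)
  open import Relation.Binary.PropositionalEquality

  prime≥2 : ∀ {p} → Prime p → 2 ≤ p
  prime≥2 {p} pp = ℕ.nonTrivial⇒n>1 p {{prime⇒nonTrivial pp}}

  prime⇒coprime-nonMultiple : ∀ {p k} → Prime p → ¬ (p ∣ k) → Coprime p k
  prime⇒coprime-nonMultiple pp p∤k (c∣p , c∣k) with prime⇒irreducible pp c∣p
  ... | inj₁ c≡1 = c≡1
  ... | inj₂ refl = ⊥-elim (p∤k c∣k)

  coprime-^ˡ : ∀ {p k} a → Coprime p k → Coprime (p ^ a) k
  coprime-^ˡ zero    _  = 1-coprimeTo _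
  coprime-^ˡ (suc a) cp = coprime-*ˡ cp (coprime-^ˡ a cp)

  ∃-prime-divisor : ∀ n → 2 ≤ n → ∃[ p ] (Prime p × p ∣ n)
  ∃-prime-divisor n@(suc (suc _)) (s≤s (s≤s z≤n)) with factorise n
  ... | record { factors = [] ; isFactorisation = () }
  ... | record { factors = p ∷ ps ; isFactorisation = n≡ ; factorsPrime = pp ∷ _ } =
    p , pp , subst (p ∣_) (sym n≡) (m∣m*n (product ps))

  split-power : ∀ p → 2 ≤ p → ∀ m → 1 ≤ m → ∃[ a ] ∃[ k ] (m ≡ p ^ a * k × ¬ (p ∣ k))
  split-power p p≥2 = <-rec _ step
    where
      step : ∀ m → (∀ {m′} → m′ < m → 1 ≤ m′ → ∃[ a ] ∃[ k ] (m′ ≡ p ^ a * k × ¬ (p ∣ k))) →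
             1 ≤ m → ∃[ a ] ∃[ k ] (m ≡ p ^ a * k × ¬ (p ∣ k))
      step m rec m≥1 with p ∣? m
      ... | no p∤m = 0 , m , sym (NP.+-identityʳ m) , p∤m
      ... | yes (divides m′ m≡) with rec m′<m m′≥1
        where
          m′≥1 = positive-factor p m′ m≥1 (trans m≡ (NP.*-comm m′ p))
          m′<m = subst (m′ <_) (sym m≡) (NP.m<m*n m′ p {{ℕ.>-nonZero m′≥1}} p≥2)
      ... | a , k , m′≡ , p∤k = suc a , k , trans m≡ (begin
        m′ * p          ≡⟨ cong (_* p) m′≡ ⟩
        p ^ a * k * p   ≡⟨ NP.*-comm (p ^ a * k) p ⟩
        p * (p ^ a * k) ≡⟨ NP.*-assoc p (p ^ a) k ⟨
        p * p ^ a * k   ∎) , p∤k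
        where open ≡-Reasoning

  primePower-induction : ∀ {ℓ} (P : ℕ → Set ℓ) → P 1 →
    (∀ p a → Prime p → 1 ≤ a → P (p ^ a)) →
    (∀ q r → 1 ≤ q → 1 ≤ r → gcd q r ≡ 1 → P q → P r → P (q * r)) →
    ∀ n → 1 ≤ n → P n
  primePower-induction P P1 Ppow P* = <-rec (λ n → 1 ≤ n → P n) step
    where
      step : ∀ n → (∀ {m} → m < n → 1 ≤ m → P m) → 1 ≤ n → P n
      step (suc zero) _ _ = P1
      step n@(suc (suc _)) rec n≥1 with ∃-prime-divisor n (s≤s (s≤s z≤n))
      ... | p , pp , p∣n with split-power p (prime≥2 pp) n n≥1
      ... | a , k , n≡ , p∤k =
        subst P (sym n≡) (P* (p ^ a) k pa≥1 k≥1 (coprime⇒gcd≡1 (coprime-^ˡ a (prime⇒coprime-nonMultiple pp p∤k)))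
                            (Ppow p a pp a≥1) (rec k<n k≥1))
        where
          p≥2 = prime≥2 pp
          pa≥1 : 1 ≤ p ^ a
          pa≥1 = NP.m^n>0 p {{ℕ.>-nonZero (NP.≤-trans (s≤s z≤n) p≥2)}} a
          k≥1 = positive-factor (p ^ a) k n≥1 n≡
          exponent≥1 : ∀ a → n ≡ p ^ a * k → 1 ≤ a
          exponent≥1 zero    n≡k = ⊥-elim (p∤k (subst (p ∣_) (trans n≡k (NP.+-identityʳ k)) p∣n))
          exponent≥1 (suc _) _   = s≤s z≤n
          a≥1 = exponent≥1 a n≡
          pa>1 : 1 < p ^ a
          pa>1 = NP.≤-trans p≥2 (subst (_≤ p ^ a) (NP.^-identityʳ p)
                   (NP.^-monoʳ-≤ p {{ℕ.>-nonZero (NP.≤-trans (s≤s z≤n) p≥2)}} a≥1))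
          k<n : k < n
          k<n = subst (k <_) (trans (NP.*-comm k (p ^ a)) (sym n≡)) (NP.m<m*n k (p ^ a) {{ℕ.>-nonZero k≥1}} pa>1)

module RegularSystems where

  open Arithmetic
  open PrimePowers
  open import Data.Bool using (Bool; true; false)
  open import Data.Nat as ℕ using (ℕ; suc; _+_; _*_; _∸_; _^_; _≤_; _<_; z≤n; s≤s; NonZero)
  import Data.Nat.Properties as NP
  open import Data.Nat.Divisibility
  open import Data.Nat.GCD using (gcd; gcd-comm)
  open import Data.Nat.Coprimality as Coprime using (coprime-divisor; coprime⇒gcd≡1; gcd≡1⇒coprime)
  open import Data.Nat.Primality using (Prime)
  open import Data.Nat.Tactic.RingSolver using (solve-∀)
  open import Data.Product using (_×_; _,_; proj₁; proj₂; ∃-syntax)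
  open import Data.Empty using (⊥-elim)
  open import Relation.Nullary using (yes; no)
  open import Relation.Binary.PropositionalEquality
  open import Function.Bundles using (_⇔_; mk⇔; Equivalence)
  open Equivalence

  module Powers (p : ℕ) (p≥2 : 2 ≤ p) where
    instance
      p-nonZero : NonZero p
      p-nonZero = ℕ.>-nonZero (NP.≤-trans (s≤s z≤n) p≥2)

    ^-positive : ∀ x → 1 ≤ p ^ x
    ^-positive x = NP.m^n>0 p x

    ^-∣⁺ : ∀ {x y} → x ≤ y → p ^ x ∣ p ^ y
    ^-∣⁺ {x} {y} x≤y = divides (p ^ (y ∸ x))
      (trans (cong (p ^_) (sym (NP.m∸n+n≡m x≤y))) (NP.^-distribˡ-+-* p (y ∸ x) x))

    ^-∣⁻ : ∀ {x y} → p ^ x ∣ p ^ y → x ≤ y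
    ^-∣⁻ {x} {y} px∣py with x ℕ.≤? y
    ... | yes x≤y = x≤y
    ... | no x≰y  = ⊥-elim (NP.<⇒≱ (NP.^-monoʳ-< p p≥2 (NP.≰⇒> x≰y))
                                    (∣⇒≤ {{ℕ.>-nonZero (^-positive y)}} px∣py))

    ^*-∣⁺ : ∀ {i j t} → j ≤ i → p ^ (j * t) ∣ p ^ (i * t)
    ^*-∣⁺ {t = t} j≤i = ^-∣⁺ (NP.*-monoˡ-≤ t j≤i)

    ^*-∣⁻ : ∀ {i j t} → 1 ≤ t → p ^ (j * t) ∣ p ^ (i * t) → j ≤ i
    ^*-∣⁻ {i} {j} {suc t} _ ∣ = NP.*-cancelʳ-≤ j i (suc t) (^-∣⁻ ∣)

    ^*-+ : ∀ i j t → p ^ (j * t) * p ^ (i * t) ≡ p ^ ((j + i) * t)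
    ^*-+ i j t = trans (sym (NP.^-distribˡ-+-* p (j * t) (i * t))) (cong (p ^_) (sym (NP.*-distribʳ-+ t j i)))

    quot-^* : ∀ s i t → i ≤ s → quot (p ^ (s * t)) (p ^ (i * t)) ≡ p ^ ((s ∸ i) * t)
    quot-^* s i t i≤s = trans (cong (λ u → quot u (p ^ (i * t))) (sym split))
                              (quot-cancelˡ (p ^ (i * t)) _ (^-positive (i * t)))
      where split : p ^ (i * t) * p ^ ((s ∸ i) * t) ≡ p ^ (s * t)
            split = trans (^*-+ (s ∸ i) i t) (cong (λ u → p ^ (u * t)) (NP.m+[n∸m]≡n i≤s))

  module RegularSystem (A : ℕ → ℕ → Bool) (reg : IsRegularSystem A) where
    open IsRegularSystem reg

    record Chain (p a : ℕ) : Set where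
      field
        t s     : ℕ
        t≥1     : 1 ≤ t
        a≡s*t   : a ≡ s * t
        members : ∀ i → i ≤ s → ∀ x → (A (p ^ (i * t)) x ≡ true) ⇔ (∃[ j ] (j ≤ i × x ≡ p ^ (j * t)))

    chain : ∀ p a → Prime p → 1 ≤ a → Chain p a
    chain p a pp a≥1 with primePow p a pp a≥1
    ... | t , divides s a≡ , members = record
      { t = t ; s = s ; t≥1 = positive-factor s t a≥1 a≡ ; a≡s*t = a≡
      ; members = λ i i≤s → members i (subst (i * t ≤_) (sym a≡) (NP.*-monoˡ-≤ t i≤s)) }

    A-split : ∀ {q r} → 1 ≤ q → 1 ≤ r → gcd q r ≡ 1 → ∀ {x} → A (q * r) x ≡ true →
              ∃[ x₁ ] ∃[ x₂ ] (A q x₁ ≡ true × A r x₂ ≡ true × x ≡ x₁ * x₂)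
    A-split {q} {r} q≥1 r≥1 coprime {x} = to (mult q r q≥1 r≥1 coprime x)

    A-join : ∀ {q r} → 1 ≤ q → 1 ≤ r → gcd q r ≡ 1 → ∀ {x₁ x₂} → A q x₁ ≡ true → A r x₂ ≡ true →
             A (q * r) (x₁ * x₂) ≡ true
    A-join {q} {r} q≥1 r≥1 coprime {x₁} {x₂} x₁∈ x₂∈ =
      from (mult q r q≥1 r≥1 coprime (x₁ * x₂)) (x₁ , x₂ , x₁∈ , x₂∈ , refl)

    A-1 : ∀ {d} → A 1 d ≡ true → d ≡ 1
    A-1 {d} = to (one d)

    1∈A-1 : A 1 1 ≡ true
    1∈A-1 = from (one 1) refl

    gcd-∣∣ : ∀ {q r d e} → gcd q r ≡ 1 → d ∣ q → e ∣ r → gcd d e ≡ 1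
    gcd-∣∣ coprime d∣q e∣r = coprime⇒gcd≡1 (coprime-∣∣ (gcd≡1⇒coprime coprime) d∣q e∣r)

    A-bound : ∀ {n d} → 1 ≤ n → A n d ≡ true → 1 ≤ d × d ≤ n
    A-bound {n} {d} n≥1 d∈ with divisor n d n≥1 d∈
    ... | d≥1 , d∣n = d≥1 , ∣⇒≤ {{ℕ.>-nonZero n≥1}} d∣n

    A-beyond : ∀ {n d} → 1 ≤ n → n < d → A n d ≡ false
    A-beyond {n} {d} n≥1 n<d with A n d in d∈
    ... | false = refl
    ... | true  = ⊥-elim (NP.<⇒≱ n<d (proj₂ (A-bound n≥1 d∈)))

    A-self : ∀ n → 1 ≤ n → A n n ≡ true
    A-self = primePower-induction (λ n → A n n ≡ true) 1∈A-1 power (λ q r q≥1 r≥1 cop → A-join q≥1 r≥1 cop)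
      where
        power : ∀ p a → Prime p → 1 ≤ a → A (p ^ a) (p ^ a) ≡ true
        power p a pp a≥1 with chain p a pp a≥1
        ... | record { s = s ; a≡s*t = refl ; members = members } =
          from (members s NP.≤-refl _) (s , NP.≤-refl , refl)

    A-quot : ∀ n → 1 ≤ n → ∀ d → A n d ≡ true → A n (quot n d) ≡ true
    A-quot = primePower-induction P base power product
      where
        P = λ n → ∀ d → A n d ≡ true → A n (quot n d) ≡ true
        base : P 1
        base d d∈ with A-1 d∈
        ... | refl = 1∈A-1
        power : ∀ p a → Prime p → 1 ≤ a → P (p ^ a)
        power p a pp a≥1 d d∈ with chain p a pp a≥1
        ... | record { t = t ; s = s ; a≡s*t = refl ; members = members } with to (members s NP.≤-refl d) d∈
        ... | i , i≤s , refl =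
          subst (λ u → A (p ^ (s * t)) u ≡ true) (sym (Powers.quot-^* p (prime≥2 pp) s i t i≤s))
                (from (members s NP.≤-refl _) (s ∸ i , NP.m∸n≤m s i , refl))
        product : ∀ q r → 1 ≤ q → 1 ≤ r → gcd q r ≡ 1 → P q → P r → P (q * r)
        product q r q≥1 r≥1 cop Pq Pr d d∈ with A-split q≥1 r≥1 cop d∈
        ... | d₁ , d₂ , d₁∈ , d₂∈ , refl with divisor q d₁ q≥1 d₁∈ | divisor r d₂ r≥1 d₂∈
        ... | d₁≥1 , d₁∣q | d₂≥1 , d₂∣r =
          subst (λ u → A (q * r) u ≡ true) (sym (quot-* d₁≥1 d₂≥1 d₁∣q d₂∣r))
                (A-join q≥1 r≥1 cop (Pq d₁ d₁∈) (Pr d₂ d₂∈))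

    A-divisors : ∀ n → 1 ≤ n → ∀ d → A n d ≡ true → ∀ e → (A d e ≡ true) ⇔ (A n e ≡ true × e ∣ d)
    A-divisors = primePower-induction P base power product
      where
        P = λ n → ∀ d → A n d ≡ true → ∀ e → (A d e ≡ true) ⇔ (A n e ≡ true × e ∣ d)
        base : P 1
        base d d∈ e with A-1 d∈
        ... | refl = mk⇔ (λ e∈ → e∈ , subst (_∣ 1) (sym (A-1 e∈)) ∣-refl) proj₁
        power : ∀ p a → Prime p → 1 ≤ a → P (p ^ a)
        power p a pp a≥1 d d∈ e with chain p a pp a≥1
        ... | record { t = t ; s = s ; t≥1 = t≥1 ; a≡s*t = refl ; members = members } with to (members s NP.≤-refl d) d∈
        ... | i , i≤s , refl = mk⇔ forth back
          where
            open Powers p (prime≥2 pp)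
            forth : A (p ^ (i * t)) e ≡ true → A (p ^ (s * t)) e ≡ true × e ∣ p ^ (i * t)
            forth e∈ with to (members i i≤s e) e∈
            ... | j , j≤i , refl = from (members s NP.≤-refl _) (j , NP.≤-trans j≤i i≤s , refl) , ^*-∣⁺ j≤i
            back : A (p ^ (s * t)) e ≡ true × e ∣ p ^ (i * t) → A (p ^ (i * t)) e ≡ true
            back (e∈ , e∣) with to (members s NP.≤-refl e) e∈
            ... | j , _ , refl = from (members i i≤s _) (j , ^*-∣⁻ t≥1 e∣ , refl)
        product : ∀ q r → 1 ≤ q → 1 ≤ r → gcd q r ≡ 1 → P q → P r → P (q * r)
        product q r q≥1 r≥1 cop Pq Pr d d∈ e with A-split q≥1 r≥1 cop d∈
        ... | d₁ , d₂ , d₁∈ , d₂∈ , refl with divisor q d₁ q≥1 d₁∈ | divisor r d₂ r≥1 d₂∈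
        ... | d₁≥1 , d₁∣q | d₂≥1 , d₂∣r = mk⇔ forth back
          where
            cop₁₂ = gcd-∣∣ cop d₁∣q d₂∣r
            forth : A (d₁ * d₂) e ≡ true → A (q * r) e ≡ true × e ∣ d₁ * d₂
            forth e∈ with A-split d₁≥1 d₂≥1 cop₁₂ e∈
            ... | e₁ , e₂ , e₁∈ , e₂∈ , refl with to (Pq d₁ d₁∈ e₁) e₁∈ | to (Pr d₂ d₂∈ e₂) e₂∈
            ... | e₁∈q , e₁∣d₁ | e₂∈r , e₂∣d₂ =
              A-join q≥1 r≥1 cop e₁∈q e₂∈r , *-pres-∣ e₁∣d₁ e₂∣d₂
            back : A (q * r) e ≡ true × e ∣ d₁ * d₂ → A (d₁ * d₂) e ≡ true
            back (e∈ , e∣) with A-split q≥1 r≥1 cop e∈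
            ... | e₁ , e₂ , e₁∈ , e₂∈ , refl with divisor q e₁ q≥1 e₁∈ | divisor r e₂ r≥1 e₂∈
            ... | _ , e₁∣q | _ , e₂∣r =
              A-join d₁≥1 d₂≥1 cop₁₂ (from (Pq d₁ d₁∈ e₁) (e₁∈ , e₁∣d₁))
                                     (from (Pr d₂ d₂∈ e₂) (e₂∈ , e₂∣d₂))
              where
                e₁∣d₁ = coprime-divisorʳ (gcd≡1⇒coprime (gcd-∣∣ cop e₁∣q d₂∣r)) (∣-trans (m∣m*n e₂) e∣)
                e₂∣d₂ = coprime-divisor (gcd≡1⇒coprime (gcd-∣∣ (trans (gcd-comm r q) cop) e₂∣r d₁∣q))
                                        (∣-trans (n∣m*n e₁) e∣)

    private
      interchange : ∀ a b c d → a * b * (c * d) ≡ a * c * (b * d)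
      interchange = solve-∀

    A-*-quot : ∀ n → 1 ≤ n → ∀ m c → A n m ≡ true → A (quot n m) c ≡ true → A n (c * m) ≡ true
    A-*-quot = primePower-induction P base power product
      where
        P = λ n → ∀ m c → A n m ≡ true → A (quot n m) c ≡ true → A n (c * m) ≡ true
        base : P 1
        base m c m∈ c∈ with A-1 m∈
        ... | refl with A-1 c∈
        ... | refl = 1∈A-1
        power : ∀ p a → Prime p → 1 ≤ a → P (p ^ a)
        power p a pp a≥1 m c m∈ c∈ with chain p a pp a≥1
        ... | record { t = t ; s = s ; a≡s*t = refl ; members = members } with to (members s NP.≤-refl m) m∈
        ... | i , i≤s , refl
          with to (members (s ∸ i) (NP.m∸n≤m s i) c) (subst (λ u → A u c ≡ true) (quot-^* s i t i≤s) c∈)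
          where open Powers p (prime≥2 pp)
        ... | j , j≤s∸i , refl =
          subst (λ u → A (p ^ (s * t)) u ≡ true) (sym (Powers.^*-+ p (prime≥2 pp) i j t))
                (from (members s NP.≤-refl _) (j + i , NP.m≤o∸n⇒m+n≤o j i≤s j≤s∸i , refl))
        product : ∀ q r → 1 ≤ q → 1 ≤ r → gcd q r ≡ 1 → P q → P r → P (q * r)
        product q r q≥1 r≥1 cop Pq Pr m x m∈ x∈ with A-split q≥1 r≥1 cop m∈
        ... | m₁ , m₂ , m₁∈ , m₂∈ , refl with divisor q m₁ q≥1 m₁∈ | divisor r m₂ r≥1 m₂∈
        ... | m₁≥1 , m₁∣q | m₂≥1 , m₂∣r with quot-∣ q≥1 m₁≥1 m₁∣q | quot-∣ r≥1 m₂≥1 m₂∣r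
        ... | q′≥1 , q′∣q | r′≥1 , r′∣r
          with A-split q′≥1 r′≥1 (gcd-∣∣ cop q′∣q r′∣r)
                       (subst (λ u → A u x ≡ true) (quot-* m₁≥1 m₂≥1 m₁∣q m₂∣r) x∈)
        ... | x₁ , x₂ , x₁∈ , x₂∈ , refl =
          subst (λ u → A (q * r) u ≡ true) (interchange x₁ m₁ x₂ m₂)
                (A-join q≥1 r≥1 cop (Pq m₁ x₁ m₁∈ x₁∈) (Pr m₂ x₂ m₂∈ x₂∈))

    greatest-A-divisor : ∀ n → 1 ≤ n → ∀ k →
      ∃[ g ] (A n g ≡ true × g ∣ k × (∀ e → (A n e ≡ true × e ∣ k) ⇔ (A g e ≡ true)))
    greatest-A-divisor = primePower-induction P base power product
      where
        P = λ n → ∀ k → ∃[ g ] (A n g ≡ true × g ∣ k × (∀ e → (A n e ≡ true × e ∣ k) ⇔ (A g e ≡ true)))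
        base : P 1
        base k = 1 , 1∈A-1 , 1∣ k , λ e → mk⇔ proj₁ (λ e∈ → e∈ , subst (_∣ k) (sym (A-1 e∈)) (1∣ k))
        power : ∀ p a → Prime p → 1 ≤ a → P (p ^ a)
        power p a pp a≥1 k with chain p a pp a≥1
        ... | record { t = t ; s = s ; t≥1 = t≥1 ; a≡s*t = refl ; members = members } =
          p ^ (b * t) , from (members s NP.≤-refl _) (b , b≤s , refl) , pbt∣k , λ e → mk⇔ (forth e) (back e)
          where
            open Powers p (prime≥2 pp)
            largest = largest-≤ (λ j → p ^ (j * t) ∣ k) (λ j → p ^ (j * t) ∣? k) (1∣ k) s
            b = proj₁ largest
            b≤s = proj₁ (proj₂ largest)
            pbt∣k = proj₁ (proj₂ (proj₂ largest))
            maximal = proj₂ (proj₂ (proj₂ largest))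
            forth : ∀ e → A (p ^ (s * t)) e ≡ true × e ∣ k → A (p ^ (b * t)) e ≡ true
            forth e (e∈ , e∣k) with to (members s NP.≤-refl e) e∈
            ... | j , j≤s , refl = from (members b b≤s _) (j , maximal j j≤s e∣k , refl)
            back : ∀ e → A (p ^ (b * t)) e ≡ true → A (p ^ (s * t)) e ≡ true × e ∣ k
            back e e∈ with to (members b b≤s e) e∈
            ... | j , j≤b , refl =
              from (members s NP.≤-refl _) (j , NP.≤-trans j≤b b≤s , refl) , ∣-trans (^*-∣⁺ j≤b) pbt∣k
        product : ∀ q r → 1 ≤ q → 1 ≤ r → gcd q r ≡ 1 → P q → P r → P (q * r)
        product q r q≥1 r≥1 cop Pq Pr k with Pq k | Pr k
        ... | g₁ , g₁∈ , g₁∣k , eq₁ | g₂ , g₂∈ , g₂∣k , eq₂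
          with divisor q g₁ q≥1 g₁∈ | divisor r g₂ r≥1 g₂∈
        ... | g₁≥1 , g₁∣q | g₂≥1 , g₂∣r =
          g₁ * g₂ , A-join q≥1 r≥1 cop g₁∈ g₂∈ , coprime⇒∣* (gcd≡1⇒coprime cop₁₂) g₁∣k g₂∣k ,
          λ e → mk⇔ (forth e) (back e)
          where
            cop₁₂ = gcd-∣∣ cop g₁∣q g₂∣r
            forth : ∀ e → A (q * r) e ≡ true × e ∣ k → A (g₁ * g₂) e ≡ true
            forth e (e∈ , e∣k) with A-split q≥1 r≥1 cop e∈
            ... | e₁ , e₂ , e₁∈ , e₂∈ , refl =
              A-join g₁≥1 g₂≥1 cop₁₂ (to (eq₁ e₁) (e₁∈ , ∣-trans (m∣m*n e₂) e∣k))
                                     (to (eq₂ e₂) (e₂∈ , ∣-trans (n∣m*n e₁) e∣k))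
            back : ∀ e → A (g₁ * g₂) e ≡ true → A (q * r) e ≡ true × e ∣ k
            back e e∈ with A-split g₁≥1 g₂≥1 cop₁₂ e∈
            ... | e₁ , e₂ , e₁∈ , e₂∈ , refl with from (eq₁ e₁) e₁∈ | from (eq₂ e₂) e₂∈
            ... | e₁∈q , e₁∣k | e₂∈r , e₂∣k with divisor q e₁ q≥1 e₁∈q | divisor r e₂ r≥1 e₂∈r
            ... | _ , e₁∣q | _ , e₂∣r =
              A-join q≥1 r≥1 cop e₁∈q e₂∈r ,
              coprime⇒∣* (gcd≡1⇒coprime (gcd-∣∣ cop e₁∣q e₂∣r)) e₁∣k e₂∣k

module Sums where

  open import Data.Bool using (Bool; true; false; if_then_else_; _∧_)
  import Data.Bool as Bool
  open import Data.Nat as ℕ using (ℕ; zero; suc; _*_; _≤_; _<_; z≤n; s≤s)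
  import Data.Nat.Properties as NP
  open import Data.Nat.Divisibility using (_∣_; _∣?_)
  open import Data.Nat.DivMod using (_/_; m*[n/m]≡n; m/n≤m)
  open import Data.List using (List; []; _∷_; _++_; filter; length)
  open import Data.List.Membership.Propositional using (_∈_)
  open import Data.List.Membership.Propositional.Properties using (∈-++⁺ˡ; ∈-++⁺ʳ)
  open import Data.List.Relation.Unary.Any using (here)
  open import Data.Product using (_×_; _,_; proj₁; proj₂; ∃-syntax)
  open import Data.Sum using (inj₁; inj₂)
  open import Data.Empty using (⊥-elim)
  open import Relation.Nullary using (¬_; Dec; yes; no; does)
  open import Relation.Nullary.Decidable using (⌊_⌋; dec-true; dec-false)
  open import Relation.Unary using (Pred; Decidable)
  open import Relation.Binary.PropositionalEquality as ≡ using (_≡_)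
  open import Function.Bundles using (_⇔_; Equivalence)

  does-≟true : ∀ b → does (b Bool.≟ true) ≡ b
  does-≟true true  = ≡.refl
  does-≟true false = ≡.refl

  does⇒ : ∀ {p} {X : Set p} (x? : Dec X) → does x? ≡ true → X
  does⇒ (yes x) _ = x

  ⌊≟⌋⁺ : ∀ {a b} → a ≡ b → ⌊ a ℕ.≟ b ⌋ ≡ true
  ⌊≟⌋⁺ {a} {b} a≡b with a ℕ.≟ b
  ... | yes _   = ≡.refl
  ... | no a≢b  = ⊥-elim (a≢b a≡b)

  ⌊≟⌋⁻ : ∀ {a b} → ⌊ a ℕ.≟ b ⌋ ≡ true → a ≡ b
  ⌊≟⌋⁻ {a} {b} _ with a ℕ.≟ b
  ... | yes a≡b = a≡b

  ∈-range1 : ∀ {x} n → 1 ≤ x → x ≤ n → x ∈ range1 n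
  ∈-range1 {x} (suc n) x≥1 x≤1+n with NP.m≤n⇒m<n∨m≡n x≤1+n
  ... | inj₁ (s≤s x≤n) = ∈-++⁺ˡ (∈-range1 n x≥1 x≤n)
  ... | inj₂ ≡.refl    = ∈-++⁺ʳ (range1 n) (here ≡.refl)
  ∈-range1 zero x≥1 x≤0 = ⊥-elim (NP.<⇒≱ x≥1 x≤0)

  module FiniteSums {c ℓ} (K : Char0Field c ℓ) where
    open Char0Field K hiding (zero)
    open import Relation.Binary.Reasoning.Setoid setoid

    when : Bool → Carrier → Carrier
    when b x = if b then x else 0ᴷ

    sumTo : ℕ → (ℕ → Carrier) → Carrier
    sumTo N F = sumK (range1 N) F

    when-congʳ : ∀ b {X Y} → X ≈ Y → when b X ≈ when b Y
    when-congʳ true  X≈Y = X≈Y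
    when-congʳ false _   = refl

    when-cong : ∀ {b₁ b₂ X Y} → b₁ ≡ b₂ → (b₂ ≡ true → X ≈ Y) → when b₁ X ≈ when b₂ Y
    when-cong {true}  ≡.refl X≈Y = X≈Y ≡.refl
    when-cong {false} ≡.refl _   = refl

    when-true : ∀ {b} X → b ≡ true → when b X ≈ X
    when-true X ≡.refl = refl

    when-false : ∀ {b} X → b ≡ false → when b X ≈ 0ᴷ
    when-false X ≡.refl = refl

    when-zero : ∀ b {X} → X ≈ 0ᴷ → when b X ≈ 0ᴷ
    when-zero true  X≈0 = X≈0
    when-zero false _   = refl

    when-*ʳ : ∀ b X a → (when b X *ᴷ a) ≈ when b (X *ᴷ a)
    when-*ʳ true  X a = refl
    when-*ʳ false X a = zeroˡ a

    when-*ˡ : ∀ b X a → (a *ᴷ when b X) ≈ when b (a *ᴷ X)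
    when-*ˡ true  X a = refl
    when-*ˡ false X a = zeroʳ a

    when-1* : ∀ b X → when b X ≈ (when b 1ᴷ *ᴷ X)
    when-1* true  X = sym (*-identityˡ X)
    when-1* false X = sym (zeroˡ X)

    when-swap : ∀ b₁ b₂ X → when b₁ (when b₂ X) ≈ when b₂ (when b₁ X)
    when-swap true  true  X = refl
    when-swap true  false X = refl
    when-swap false true  X = refl
    when-swap false false X = refl

    when-∧ : ∀ b₁ b₂ X → when b₁ (X *ᴷ when b₂ 1ᴷ) ≈ when (b₁ ∧ b₂) X
    when-∧ true  true  X = *-identityʳ X
    when-∧ true  false X = zeroʳ X
    when-∧ false b₂    X = refl

    when-when : ∀ b₁ b₂ b₃ b₄ {X Y} → ((b₁ ≡ true × b₂ ≡ true) ⇔ (b₃ ≡ true × b₄ ≡ true)) → X ≈ Y →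
                when b₁ (when b₂ X) ≈ when b₃ (when b₄ Y)
    when-when true true b₃ b₄ iff X≈Y with Equivalence.to iff (≡.refl , ≡.refl)
    ... | ≡.refl , ≡.refl = X≈Y
    when-when true false true true iff _ with Equivalence.from iff (≡.refl , ≡.refl)
    ... | _ , ()
    when-when false b₂ true true iff _ with Equivalence.from iff (≡.refl , ≡.refl)
    ... | () , _
    when-when true  false true  false _ _ = refl
    when-when true  false false _     _ _ = refl
    when-when false _     true  false _ _ = refl
    when-when false _     false _     _ _ = refl

    sumK-++ : ∀ xs ys F → sumK (xs ++ ys) F ≈ (sumK xs F +ᴷ sumK ys F)
    sumK-++ []       ys F = sym (+-identityˡ _)
    sumK-++ (x ∷ xs) ys F = trans (+-cong refl (sumK-++ xs ys F)) (sym (+-assoc _ _ _))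

    sumTo-suc : ∀ N F → sumTo (suc N) F ≈ (sumTo N F +ᴷ F (suc N))
    sumTo-suc N F = trans (sumK-++ (range1 N) (suc N ∷ []) F) (+-cong refl (+-identityʳ _))

    sumK-cong : ∀ xs {F G} → (∀ x → F x ≈ G x) → sumK xs F ≈ sumK xs G
    sumK-cong []       F≈G = refl
    sumK-cong (x ∷ xs) F≈G = +-cong (F≈G x) (sumK-cong xs F≈G)

    sumTo-cong : ∀ N {F G} → (∀ x → 1 ≤ x → x ≤ N → F x ≈ G x) → sumTo N F ≈ sumTo N G
    sumTo-cong zero    F≈G = refl
    sumTo-cong (suc N) {F} {G} F≈G = begin
      sumTo (suc N) F       ≈⟨ sumTo-suc N F ⟩
      sumTo N F +ᴷ F (suc N) ≈⟨ +-cong (sumTo-cong N (λ x x≥1 x≤N → F≈G x x≥1 (NP.m≤n⇒m≤1+n x≤N)))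
                                       (F≈G (suc N) (s≤s z≤n) NP.≤-refl) ⟩
      sumTo N G +ᴷ G (suc N) ≈⟨ sym (sumTo-suc N G) ⟩
      sumTo (suc N) G       ∎

    sumK-0 : ∀ xs → sumK xs (λ _ → 0ᴷ) ≈ 0ᴷ
    sumK-0 []       = refl
    sumK-0 (x ∷ xs) = trans (+-identityˡ _) (sumK-0 xs)

    sumTo-0 : ∀ N {F} → (∀ x → 1 ≤ x → x ≤ N → F x ≈ 0ᴷ) → sumTo N F ≈ 0ᴷ
    sumTo-0 N F≈0 = trans (sumTo-cong N F≈0) (sumK-0 (range1 N))

    sumK-+ : ∀ xs F G → sumK xs (λ x → F x +ᴷ G x) ≈ (sumK xs F +ᴷ sumK xs G)
    sumK-+ []       F G = sym (+-identityˡ _)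
    sumK-+ (x ∷ xs) F G = begin
      (F x +ᴷ G x) +ᴷ sumK xs (λ x → F x +ᴷ G x) ≈⟨ +-cong refl (sumK-+ xs F G) ⟩
      (F x +ᴷ G x) +ᴷ (sumK xs F +ᴷ sumK xs G)   ≈⟨ +-assoc _ _ _ ⟩
      F x +ᴷ (G x +ᴷ (sumK xs F +ᴷ sumK xs G))   ≈⟨ +-cong refl (trans (sym (+-assoc _ _ _))
                                                     (trans (+-cong (+-comm _ _) refl) (+-assoc _ _ _))) ⟩
      F x +ᴷ (sumK xs F +ᴷ (G x +ᴷ sumK xs G))   ≈⟨ sym (+-assoc _ _ _) ⟩
      (F x +ᴷ sumK xs F) +ᴷ (G x +ᴷ sumK xs G)   ∎

    sumK-*ˡ : ∀ xs a F → (a *ᴷ sumK xs F) ≈ sumK xs (λ x → a *ᴷ F x)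
    sumK-*ˡ []       a F = zeroʳ a
    sumK-*ˡ (x ∷ xs) a F = trans (distribˡ a _ _) (+-cong refl (sumK-*ˡ xs a F))

    sumK-*ʳ : ∀ xs a F → (sumK xs F *ᴷ a) ≈ sumK xs (λ x → F x *ᴷ a)
    sumK-*ʳ xs a F = trans (*-comm _ _) (trans (sumK-*ˡ xs a F) (sumK-cong xs (λ x → *-comm _ _)))

    sumK-comm : ∀ xs ys (F : ℕ → ℕ → Carrier) →
                sumK xs (λ x → sumK ys (F x)) ≈ sumK ys (λ y → sumK xs (λ x → F x y))
    sumK-comm []       ys F = sym (sumK-0 ys)
    sumK-comm (x ∷ xs) ys F = begin
      sumK ys (F x) +ᴷ sumK xs (λ x → sumK ys (F x))              ≈⟨ +-cong refl (sumK-comm xs ys F) ⟩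
      sumK ys (F x) +ᴷ sumK ys (λ y → sumK xs (λ x → F x y))      ≈⟨ sym (sumK-+ ys (F x) _) ⟩
      sumK ys (λ y → sumK (x ∷ xs) (λ x → F x y))                 ∎

    sumK-when : ∀ b xs F → when b (sumK xs F) ≈ sumK xs (λ x → when b (F x))
    sumK-when true  xs F = refl
    sumK-when false xs F = sym (sumK-0 xs)

    sumK-filter : ∀ {p} {Q : Pred ℕ p} (Q? : Decidable Q) xs F →
                  sumK (filter Q? xs) F ≈ sumK xs (λ x → when (does (Q? x)) (F x))
    sumK-filter Q? []       F = refl
    sumK-filter Q? (x ∷ xs) F with does (Q? x)
    ... | true  = +-cong refl (sumK-filter Q? xs F)
    ... | false = trans (sumK-filter Q? xs F) (sym (+-identityˡ _))

    sumK-filter-≡true : ∀ (P : ℕ → Bool) xs F →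
                        sumK (filter (λ x → P x Bool.≟ true) xs) F ≈ sumK xs (λ x → when (P x) (F x))
    sumK-filter-≡true P xs F = trans (sumK-filter (λ x → P x Bool.≟ true) xs F)
                                     (sumK-cong xs (λ x → reflexive (≡.cong (λ b → when b (F x)) (does-≟true (P x)))))

    sumTo-single : ∀ N (P : ℕ → Bool) (H : ℕ → Carrier) x₀ → 1 ≤ x₀ → x₀ ≤ N → P x₀ ≡ true →
                   (∀ x → 1 ≤ x → x ≤ N → P x ≡ true → x ≡ x₀) →
                   sumTo N (λ x → when (P x) (H x)) ≈ H x₀
    sumTo-single zero    P H x₀ x₀≥1 x₀≤0 _ _ = ⊥-elim (NP.<⇒≱ x₀≥1 x₀≤0)
    sumTo-single (suc N) P H x₀ x₀≥1 x₀≤N Px₀ unique with NP.m≤n⇒m<n∨m≡n x₀≤N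
    ... | inj₁ (s≤s x₀≤N′) = begin
      sumTo (suc N) T          ≈⟨ sumTo-suc N T ⟩
      sumTo N T +ᴷ T (suc N)   ≈⟨ +-cong (sumTo-single N P H x₀ x₀≥1 x₀≤N′ Px₀
                                            (λ x x≥1 x≤N → unique x x≥1 (NP.m≤n⇒m≤1+n x≤N)))
                                         (when-false _ last-false) ⟩
      H x₀ +ᴷ 0ᴷ               ≈⟨ +-identityʳ _ ⟩
      H x₀                     ∎
      where
        T = λ x → when (P x) (H x)
        last-false : P (suc N) ≡ false
        last-false with P (suc N) in eq
        ... | false = ≡.refl
        ... | true  = ⊥-elim (NP.<⇒≢ (s≤s x₀≤N′) (≡.sym (unique (suc N) (s≤s z≤n) NP.≤-refl eq)))
    ... | inj₂ ≡.refl = begin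
      sumTo (suc N) T          ≈⟨ sumTo-suc N T ⟩
      sumTo N T +ᴷ T (suc N)   ≈⟨ +-cong (sumTo-0 N (λ x x≥1 x≤N → when-false _ (others-false x x≥1 x≤N)))
                                         (when-true _ Px₀) ⟩
      0ᴷ +ᴷ H (suc N)          ≈⟨ +-identityˡ _ ⟩
      H (suc N)                ∎
      where
        T = λ x → when (P x) (H x)
        others-false : ∀ x → 1 ≤ x → x ≤ N → P x ≡ false
        others-false x x≥1 x≤N with P x in eq
        ... | false = ≡.refl
        ... | true  = ⊥-elim (NP.<⇒≢ (s≤s x≤N) (unique x x≥1 (NP.m≤n⇒m≤1+n x≤N) eq))

    sumTo-extend : ∀ N M F → N ≤ M → (∀ x → N < x → x ≤ M → F x ≈ 0ᴷ) → sumTo M F ≈ sumTo N F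
    sumTo-extend N zero    F z≤n _ = refl
    sumTo-extend N (suc M) F N≤M F≈0 with NP.m≤n⇒m<n∨m≡n N≤M
    ... | inj₂ ≡.refl = refl
    ... | inj₁ (s≤s N≤M′) = begin
      sumTo (suc M) F         ≈⟨ sumTo-suc M F ⟩
      sumTo M F +ᴷ F (suc M)  ≈⟨ +-cong (sumTo-extend N M F N≤M′ (λ x N<x x≤M → F≈0 x N<x (NP.m≤n⇒m≤1+n x≤M)))
                                        (F≈0 (suc M) (s≤s N≤M′) NP.≤-refl) ⟩
      sumTo N F +ᴷ 0ᴷ         ≈⟨ +-identityʳ _ ⟩
      sumTo N F               ∎

    -- Both sides equal the double sum of [e = d δ] G(e) over e, δ ≤ N.
    sumTo-multiples : ∀ N d G → 1 ≤ d → (∀ e → ¬ (d ∣ e) → G e ≈ 0ᴷ) → (∀ e → N < e → G e ≈ 0ᴷ) →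
                      sumTo N G ≈ sumTo N (λ δ → G (d * δ))
    sumTo-multiples N d@(suc _) G _ G≈0-off G≈0-beyond = sym (begin
      sumTo N (λ δ → G (d * δ))                ≈⟨ sumTo-cong N by-δ ⟩
      sumTo N (λ δ → sumTo N (λ e → T e δ))    ≈⟨ sumK-comm (range1 N) (range1 N) (λ δ e → T e δ) ⟩
      sumTo N (λ e → sumTo N (T e))            ≈⟨ sumTo-cong N by-e ⟩
      sumTo N G                                ∎)
      where
        T : ℕ → ℕ → Carrier
        T e δ = when (does (e ℕ.≟ d * δ)) (G e)
        by-δ : ∀ δ → 1 ≤ δ → δ ≤ N → G (d * δ) ≈ sumTo N (λ e → T e δ)
        by-δ δ δ≥1 _ with d * δ ℕ.≤? N
        ... | yes dδ≤N = sym (sumTo-single N (λ e → does (e ℕ.≟ d * δ)) G (d * δ)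
                               (NP.≤-trans δ≥1 (NP.m≤n*m δ d)) dδ≤N (dec-true (d * δ ℕ.≟ d * δ) ≡.refl)
                               (λ x _ _ → does⇒ (x ℕ.≟ d * δ)))
        ... | no dδ≰N = trans (G≈0-beyond _ (NP.≰⇒> dδ≰N))
                              (sym (sumTo-0 N (λ e _ e≤N → when-false _ (dec-false (e ℕ.≟ d * δ)
                                                             (λ { ≡.refl → dδ≰N e≤N })))))
        by-e : ∀ e → 1 ≤ e → e ≤ N → sumTo N (T e) ≈ G e
        by-e e e≥1 e≤N with d ∣? e
        ... | no d∤e = trans (sumTo-0 N (λ δ _ _ → when-zero _ (G≈0-off e d∤e))) (sym (G≈0-off e d∤e))
        ... | yes d∣e = sumTo-single N (λ δ → does (e ℕ.≟ d * δ)) (λ _ → G e) (e / d) e/d≥1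
                          (NP.≤-trans (m/n≤m e d) e≤N) (dec-true (e ℕ.≟ d * (e / d)) (≡.sym (m*[n/m]≡n d∣e)))
                          (λ x _ _ e≡dx → NP.*-cancelˡ-≡ x (e / d) d
                                            (≡.trans (≡.sym (does⇒ (e ℕ.≟ d * x) e≡dx)) (≡.sym (m*[n/m]≡n d∣e))))
          where
            e/d≥1 : 1 ≤ e / d
            e/d≥1 with e / d in eq
            ... | suc _ = s≤s z≤n
            ... | zero  = ⊥-elim (NP.<⇒≢ e≥1 (≡.sym (≡.trans (≡.sym (m*[n/m]≡n d∣e))
                                                      (≡.trans (≡.cong (d *_) eq) (NP.*-zeroʳ d)))))

    sumTo-bijection : ∀ N (σ : ℕ → ℕ) F →
      (∀ x → 1 ≤ x → x ≤ N → 1 ≤ σ x × σ x ≤ N) →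
      (∀ k → 1 ≤ k → k ≤ N → ∃[ x ] (1 ≤ x × x ≤ N × σ x ≡ k)) →
      (∀ x y → 1 ≤ x → x ≤ N → 1 ≤ y → y ≤ N → σ x ≡ σ y → x ≡ y) →
      sumTo N (λ x → F (σ x)) ≈ sumTo N F
    sumTo-bijection N σ F into onto injective = begin
      sumTo N (λ x → F (σ x))                ≈⟨ sumTo-cong N by-x ⟩
      sumTo N (λ x → sumTo N (T x))          ≈⟨ sumK-comm (range1 N) (range1 N) T ⟩
      sumTo N (λ k → sumTo N (λ x → T x k))  ≈⟨ sumTo-cong N by-k ⟩
      sumTo N F                              ∎
      where
        T : ℕ → ℕ → Carrier
        T x k = when (does (σ x ℕ.≟ k)) (F k)
        by-x : ∀ x → 1 ≤ x → x ≤ N → F (σ x) ≈ sumTo N (T x)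
        by-x x x≥1 x≤N = sym (sumTo-single N (λ k → does (σ x ℕ.≟ k)) F (σ x)
                               (proj₁ (into x x≥1 x≤N)) (proj₂ (into x x≥1 x≤N))
                               (dec-true (σ x ℕ.≟ σ x) ≡.refl) (λ k _ _ → ≡.sym ∘′ does⇒ (σ x ℕ.≟ k)))
          where open import Function using (_∘′_)
        by-k : ∀ k → 1 ≤ k → k ≤ N → sumTo N (λ x → T x k) ≈ F k
        by-k k k≥1 k≤N with onto k k≥1 k≤N
        ... | x₀ , x₀≥1 , x₀≤N , σx₀≡k =
          sumTo-single N (λ x → does (σ x ℕ.≟ k)) (λ _ → F k) x₀ x₀≥1 x₀≤N (dec-true (σ x₀ ℕ.≟ k) σx₀≡k)
            (λ x x≥1 x≤N σx≡k → injective x x₀ x≥1 x≤N x₀≥1 x₀≤N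
                                   (≡.trans (does⇒ (σ x ℕ.≟ k) σx≡k) (≡.sym σx₀≡k)))

    ι-length-filter : ∀ {p} {Q : Pred ℕ p} (Q? : Decidable Q) xs →
                      ι (length (filter Q? xs)) ≈ sumK xs (λ x → when (does (Q? x)) 1ᴷ)
    ι-length-filter Q? []       = refl
    ι-length-filter Q? (x ∷ xs) with does (Q? x)
    ... | true  = +-cong refl (ι-length-filter Q? xs)
    ... | false = trans (ι-length-filter Q? xs) (sym (+-identityˡ _))

    ι-nonZero : ∀ m → 1 ≤ m → ¬ (ι m ≈ 0ᴷ)
    ι-nonZero m m≥1 ιm≈0 with char0 m ιm≈0
    ... | ≡.refl = NP.<⇒≱ m≥1 z≤n

    *-cancelˡ-0 : ∀ x y → ¬ (x ≈ 0ᴷ) → (x *ᴷ y) ≈ 0ᴷ → y ≈ 0ᴷ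
    *-cancelˡ-0 x y x≉0 xy≈0 = begin
      y                   ≈⟨ sym (*-identityˡ y) ⟩
      1ᴷ *ᴷ y             ≈⟨ *-cong (sym (trans (*-comm _ _) (inverseʳ x x≉0))) refl ⟩
      ((x ⁻¹) *ᴷ x) *ᴷ y  ≈⟨ *-assoc _ _ _ ⟩
      (x ⁻¹) *ᴷ (x *ᴷ y)  ≈⟨ *-cong refl xy≈0 ⟩
      (x ⁻¹) *ᴷ 0ᴷ        ≈⟨ zeroʳ _ ⟩
      0ᴷ                  ∎

    *-inverse-cancelʳ : ∀ x y → ¬ (x ≈ 0ᴷ) → ((y *ᴷ x) *ᴷ (x ⁻¹)) ≈ y
    *-inverse-cancelʳ x y x≉0 = begin
      (y *ᴷ x) *ᴷ (x ⁻¹)  ≈⟨ *-assoc _ _ _ ⟩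
      y *ᴷ (x *ᴷ (x ⁻¹))  ≈⟨ *-cong refl (inverseʳ x x≉0) ⟩
      y *ᴷ 1ᴷ             ≈⟨ *-identityʳ y ⟩
      y                   ∎

module AMobius where

  open Arithmetic
  open Sums
  open RegularSystems
  open import Data.Bool using (Bool; true; false; _∧_)
  import Data.Bool as Bool
  open import Data.Nat as ℕ using (ℕ; _*_; _≤_; _⊔_; z≤n)
  import Data.Nat.Properties as NP
  open import Data.Nat.Divisibility
  open import Data.List using ([]; _∷_; filter; foldr)
  open import Data.List.Membership.Propositional using (_∈_)
  open import Data.List.Membership.Propositional.Properties using (∈-filter⁺; ∈-filter⁻)
  open import Data.List.Relation.Unary.Any using (here; there)
  open import Data.Product using (_×_; _,_; proj₁; proj₂)
  open import Data.Empty using (⊥-elim)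
  open import Relation.Nullary using (¬_; yes; no; does)
  open import Relation.Nullary.Decidable using (⌊_⌋; dec-true)
  open import Relation.Binary.PropositionalEquality as ≡ using (_≡_; refl; cong)
  open import Function.Bundles using (_⇔_; mk⇔; Equivalence)
  open Equivalence

  foldr-⊔-maximum : ∀ xs g → (∀ x → x ∈ xs → x ≤ g) → g ∈ xs → foldr _⊔_ 0 xs ≡ g
  foldr-⊔-maximum xs g bound g∈xs = NP.≤-antisym (upper xs bound) (lower xs g∈xs)
    where
      upper : ∀ xs → (∀ x → x ∈ xs → x ≤ g) → foldr _⊔_ 0 xs ≤ g
      upper []       _     = z≤n
      upper (y ∷ ys) bound = NP.⊔-lub (bound y (here refl)) (upper ys (λ x x∈ → bound x (there x∈)))
      lower : ∀ xs → g ∈ xs → g ≤ foldr _⊔_ 0 xs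
      lower (y ∷ ys) (here refl) = NP.m≤m⊔n y _
      lower (y ∷ ys) (there g∈)  = NP.≤-trans (lower ys g∈) (NP.m≤n⊔m y _)

  module AMobiusInversion {c ℓ} (K : Char0Field c ℓ) (A : ℕ → ℕ → Bool) (reg : IsRegularSystem A)
                          (μ : ℕ → Char0Field.Carrier K) (isMobius : IsMobiusA K A μ)
                          (f : ℕ → Char0Field.Carrier K) where
    open Char0Field K hiding (zero) renaming (refl to ≈-refl)
    open FiniteSums K
    open RegularSystem A reg
    open IsRegularSystem reg
    open import Relation.Binary.Reasoning.Setoid setoid

    μ*f : ℕ → Carrier
    μ*f = convA K A μ f

    μ*1 : ℕ → Carrier
    μ*1 = convA K A μ (λ _ → 1ᴷ)

    sumK-elemsA : ∀ n N F → 1 ≤ n → n ≤ N → sumK (elemsA A n) F ≈ sumTo N (λ e → when (A n e) (F e))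
    sumK-elemsA n N F n≥1 n≤N = begin
      sumK (elemsA A n) F                 ≈⟨ sumK-filter-≡true (A n) (range1 n) F ⟩
      sumTo n (λ e → when (A n e) (F e))  ≈⟨ sumTo-extend n N _ n≤N beyond ⟨
      sumTo N (λ e → when (A n e) (F e))  ∎
      where beyond = λ x n<x _ → when-false (F x) (A-beyond n≥1 n<x)

    -- (e, c) ↦ (e / c, c) matches c ∈ A(e), e ∈ A(g) with c ∈ A(g / m), m ∈ A(g).
    A-tower⇔ : ∀ g c m → 1 ≤ g → 1 ≤ c → 1 ≤ m →
               (A g (c * m) ≡ true × A (c * m) c ≡ true) ⇔ (A g m ≡ true × A (quot g m) c ≡ true)
    A-tower⇔ g c m g≥1 c≥1 m≥1 = mk⇔ forth back
      where
        forth : A g (c * m) ≡ true × A (c * m) c ≡ true → A g m ≡ true × A (quot g m) c ≡ true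
        forth (cm∈ , c∈) = m∈ , from (A-divisors g g≥1 (quot g m) (A-quot g g≥1 m m∈) c) (c∈g , c∣g/m)
          where
            m∈cm = ≡.subst (λ u → A (c * m) u ≡ true) (quot-cancelˡ c m c≥1)
                           (A-quot (c * m) (NP.*-mono-≤ c≥1 m≥1) c c∈)
            m∈  = proj₁ (to (A-divisors g g≥1 (c * m) cm∈ m) m∈cm)
            c∈g = proj₁ (to (A-divisors g g≥1 (c * m) cm∈ c) c∈)
            c∣g/m : c ∣ quot g m
            c∣g/m = *-cancelʳ-∣ m {{ℕ.>-nonZero m≥1}}
                      (≡.subst (c * m ∣_) (≡.trans (quot-correct m≥1 (proj₂ (divisor g m g≥1 m∈))) (NP.*-comm m (quot g m)))
                               (proj₂ (divisor g (c * m) g≥1 cm∈)))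
        back : A g m ≡ true × A (quot g m) c ≡ true → A g (c * m) ≡ true × A (c * m) c ≡ true
        back (m∈ , c∈) = cm∈ , from (A-divisors g g≥1 (c * m) cm∈ c) (c∈g , m∣m*n m)
          where
            cm∈ = A-*-quot g g≥1 m c m∈ c∈
            c∈g = proj₁ (to (A-divisors g g≥1 (quot g m) (A-quot g g≥1 m m∈) c) c∈)

    -- ((μ * f) * 1)(g) = (f * (μ * 1))(g): both are sums over the pairs c, m with c m ∈ A(g).
    sum-convA-exchange : ∀ g → 1 ≤ g →
      sumTo g (λ e → when (A g e) (μ*f e)) ≈ sumTo g (λ m → when (A g m) (f m *ᴷ μ*1 (quot g m)))
    sum-convA-exchange g g≥1 = begin
      sumTo g (λ e → when (A g e) (μ*f e))         ≈⟨ sumTo-cong g expand ⟩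
      sumTo g (λ e → sumTo g (λ c → T e c))        ≈⟨ sumK-comm (range1 g) (range1 g) T ⟩
      sumTo g (λ c → sumTo g (λ e → T e c))        ≈⟨ sumTo-cong g multiples ⟩
      sumTo g (λ c → sumTo g (λ m → T (c * m) c))  ≈⟨ sumTo-cong g (λ c c≥1 _ → sumTo-cong g (tower c c≥1)) ⟩
      sumTo g (λ c → sumTo g (λ m → T′ m c))       ≈⟨ sumK-comm (range1 g) (range1 g) (λ c m → T′ m c) ⟩
      sumTo g (λ m → sumTo g (T′ m))               ≈⟨ sumTo-cong g collapse ⟩
      sumTo g (λ m → when (A g m) (f m *ᴷ μ*1 (quot g m))) ∎
      where
        T : ℕ → ℕ → Carrier
        T e c = when (A g e) (when (A e c) (μ c *ᴷ f (quot e c)))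
        T′ : ℕ → ℕ → Carrier
        T′ m c = when (A g m) (when (A (quot g m) c) (μ c *ᴷ f m))
        expand : ∀ e → 1 ≤ e → e ≤ g → when (A g e) (μ*f e) ≈ sumTo g (T e)
        expand e e≥1 e≤g = trans (when-congʳ (A g e) (sumK-elemsA e g _ e≥1 e≤g)) (sumK-when (A g e) (range1 g) _)
        off-multiples : ∀ c e → ¬ (c ∣ e) → T e c ≈ 0ᴷ
        off-multiples c e c∤e with A g e in e∈
        ... | false = ≈-refl
        ... | true with A e c in c∈
        ...   | false = ≈-refl
        ...   | true  = ⊥-elim (c∤e (proj₂ (divisor e c (proj₁ (A-bound g≥1 e∈)) c∈)))
        multiples : ∀ c → 1 ≤ c → c ≤ g → sumTo g (λ e → T e c) ≈ sumTo g (λ m → T (c * m) c)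
        multiples c c≥1 _ = sumTo-multiples g c (λ e → T e c) c≥1 (off-multiples c)
                                            (λ e g<e → when-false _ (A-beyond g≥1 g<e))
        tower : ∀ c → 1 ≤ c → ∀ m → 1 ≤ m → m ≤ g → T (c * m) c ≈ T′ m c
        tower c c≥1 m m≥1 _ = when-when (A g (c * m)) (A (c * m) c) (A g m) (A (quot g m) c) (A-tower⇔ g c m g≥1 c≥1 m≥1)
                                      (*-cong ≈-refl (reflexive (cong f (quot-cancelˡ c m c≥1))))
        collapse : ∀ m → 1 ≤ m → m ≤ g → sumTo g (T′ m) ≈ when (A g m) (f m *ᴷ μ*1 (quot g m))
        collapse m m≥1 _ with A g m in m∈
        ... | false = sumK-0 (range1 g)
        ... | true  = begin
          sumTo g (λ c → when (A q c) (μ c *ᴷ f m))        ≈⟨ sumK-cong (range1 g) pull-f ⟩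
          sumTo g (λ c → when (A q c) (μ c *ᴷ 1ᴷ) *ᴷ f m)  ≈⟨ sumK-*ʳ (range1 g) (f m) _ ⟨
          sumTo g (λ c → when (A q c) (μ c *ᴷ 1ᴷ)) *ᴷ f m  ≈⟨ *-cong (sumK-elemsA q g _ q≥1 q≤g) ≈-refl ⟨
          μ*1 q *ᴷ f m                                     ≈⟨ *-comm _ _ ⟩
          f m *ᴷ μ*1 q                                     ∎
          where
            q = quot g m
            q≥1 = proj₁ (quot-∣ g≥1 m≥1 (proj₂ (divisor g m g≥1 m∈)))
            q≤g = ∣⇒≤ {{ℕ.>-nonZero g≥1}} (proj₂ (quot-∣ g≥1 m≥1 (proj₂ (divisor g m g≥1 m∈))))
            pull-f : ∀ c → when (A q c) (μ c *ᴷ f m) ≈ (when (A q c) (μ c *ᴷ 1ᴷ) *ᴷ f m)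
            pull-f c = sym (trans (when-*ʳ (A q c) _ (f m)) (when-congʳ (A q c) (*-cong (*-identityʳ _) ≈-refl)))

    inversion : ∀ g → 1 ≤ g → sumK (elemsA A g) μ*f ≈ f g
    inversion g g≥1 = begin
      sumK (elemsA A g) μ*f                                    ≈⟨ sumK-elemsA g g μ*f g≥1 NP.≤-refl ⟩
      sumTo g (λ e → when (A g e) (μ*f e))                     ≈⟨ sum-convA-exchange g g≥1 ⟩
      sumTo g (λ m → when (A g m) (f m *ᴷ μ*1 (quot g m)))     ≈⟨ sumTo-cong g μ*1≈δ ⟩
      sumTo g (λ m → when (A g m) (f m *ᴷ when ⌊ quot g m ℕ.≟ 1 ⌋ 1ᴷ))
                                                               ≈⟨ sumTo-cong g (λ m _ _ → when-∧ (A g m) _ (f m)) ⟩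
      sumTo g (λ m → when (A g m ∧ ⌊ quot g m ℕ.≟ 1 ⌋) (f m))  ≈⟨ sumTo-single g _ f g g≥1 NP.≤-refl g-selected only-g ⟩
      f g                                                      ∎
      where
        μ*1≈δ : ∀ m → 1 ≤ m → m ≤ g → when (A g m) (f m *ᴷ μ*1 (quot g m)) ≈ when (A g m) (f m *ᴷ when ⌊ quot g m ℕ.≟ 1 ⌋ 1ᴷ)
        μ*1≈δ m m≥1 _ = when-cong refl (λ m∈ →
          *-cong ≈-refl (isMobius (quot g m) (proj₁ (quot-∣ g≥1 m≥1 (proj₂ (divisor g m g≥1 m∈))))))
        g-selected : (A g g ∧ ⌊ quot g g ℕ.≟ 1 ⌋) ≡ true
        g-selected rewrite A-self g g≥1 =
          ⌊≟⌋⁺ (≡.trans (cong (λ u → quot u g) (≡.sym (NP.*-identityʳ g))) (quot-cancelˡ g 1 g≥1))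
        only-g : ∀ x → 1 ≤ x → x ≤ g → (A g x ∧ ⌊ quot g x ℕ.≟ 1 ⌋) ≡ true → x ≡ g
        only-g x x≥1 _ sel with A g x in x∈
        ... | true = ≡.sym (≡.trans (quot-correct x≥1 (proj₂ (divisor g x g≥1 x∈)))
                                    (≡.trans (cong (x *_) (⌊≟⌋⁻ sel)) (NP.*-identityʳ x)))

    f-gcdA : ∀ n → 1 ≤ n → ∀ k → f (gcdA A k n) ≈ sumTo n (λ e → when (A n e) (when (does (e ∣? k)) (μ*f e)))
    f-gcdA n n≥1 k with greatest-A-divisor n n≥1 k
    ... | g , g∈ , g∣k , divisors-of-g = begin
      f (gcdA A k n)                        ≈⟨ reflexive (cong f gcdA≡g) ⟩
      f g                                   ≈⟨ inversion g g≥1 ⟨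
      sumK (elemsA A g) μ*f                 ≈⟨ sumK-elemsA g n μ*f g≥1 g≤n ⟩
      sumTo n (λ e → when (A g e) (μ*f e))  ≈⟨ sumK-cong (range1 n) same-terms ⟩
      sumTo n (λ e → when (A n e) (when (does (e ∣? k)) (μ*f e))) ∎
      where
        g≥1 = proj₁ (A-bound n≥1 g∈)
        g≤n = proj₂ (A-bound n≥1 g∈)
        candidates = filter (_∣? k) (elemsA A n)
        gcdA≡g : gcdA A k n ≡ g
        gcdA≡g = foldr-⊔-maximum candidates g bound
                   (∈-filter⁺ (_∣? k) (∈-filter⁺ (λ d → A n d Bool.≟ true) (∈-range1 n g≥1 g≤n) g∈) g∣k)
          where
            bound : ∀ x → x ∈ candidates → x ≤ g
            bound x x∈ with ∈-filter⁻ (_∣? k) {xs = elemsA A n} x∈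
            ... | x∈A , x∣k with ∈-filter⁻ (λ d → A n d Bool.≟ true) {xs = range1 n} x∈A
            ... | _ , x∈n = ∣⇒≤ {{ℕ.>-nonZero g≥1}} (proj₂ (divisor g x g≥1 (to (divisors-of-g x) (x∈n , x∣k))))
        same-terms : ∀ e → when (A g e) (μ*f e) ≈ when (A n e) (when (does (e ∣? k)) (μ*f e))
        same-terms e with A g e in e∈g
        ... | true with from (divisors-of-g e) e∈g
        ...   | e∈n , e∣k rewrite e∈n | dec-true (e ∣? k) e∣k = ≈-refl
        same-terms e | false with A n e in e∈n | e ∣? k
        ... | false | _       = ≈-refl
        ... | true  | no _    = ≈-refl
        ... | true  | yes e∣k with ≡.trans (≡.sym e∈g) (to (divisors-of-g e) (e∈n , e∣k))
        ...   | ()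

module Totient where

  open Arithmetic
  open Sums
  open import Data.Nat as ℕ using (ℕ; _+_; _*_; _∸_; _%_; _≤_; z≤n; s≤s; NonZero)
  import Data.Nat.Properties as NP
  open import Data.Nat.Divisibility
  open import Data.Nat.DivMod using (m∣n⇒o%n%m≡o%m)
  open import Data.Nat.GCD using (gcd)
  open import Data.Nat.Coprimality as Coprime using (Coprime; coprime⇒gcd≡1; gcd≡1⇒coprime; 1-coprimeTo)
  open import Data.List using (List; length)
  open import Data.List.Membership.Propositional using (_∈_)
  open import Data.List.Membership.Propositional.Properties using (∈-filter⁺)
  open import Data.List.Relation.Unary.Any using (here; there)
  open import Data.Product using (_×_; _,_; proj₁; proj₂; ∃-syntax)
  open import Relation.Nullary using (¬_; Dec; yes; no; does)
  open import Relation.Nullary.Decidable using (dec-true; dec-false; does-⇔)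
  open import Relation.Binary.PropositionalEquality as ≡ using (_≡_; refl; cong)
  open import Function.Bundles using (_⇔_; mk⇔; Equivalence)

  residue-%-∣ : ∀ {e} n .{{_ : NonZero n}} .{{_ : NonZero e}} x → e ∣ n → residue n x % e ≡ x % e
  residue-%-∣ {e} n x e∣n = ≡.trans (≡.sym (m∣n⇒o%n%m≡o%m e n (residue n x) e∣n))
                              (≡.trans (cong (_% e) (residue-% n x)) (m∣n⇒o%n%m≡o%m e n x e∣n))

  coprime-residue-* : ∀ {u} n .{{_ : NonZero n}} j → Coprime u n → Coprime (residue n (u * j)) n ⇔ Coprime j n
  coprime-residue-* {u} n j cu = mk⇔ forth back
    where
      forth : Coprime (residue n (u * j)) n → Coprime j n
      forth c = coprime-∣ˡ (n∣m*n u) (coprime-%-cong n (residue-% n (u * j)) c)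
      back : Coprime j n → Coprime (residue n (u * j)) n
      back c = coprime-%-cong n (≡.sym (residue-% n (u * j))) (coprime-*ˡ cu c)

  residue-*-surjective : ∀ {u} n .{{_ : NonZero n}} → Coprime u n →
                         ∀ k → 1 ≤ k → k ≤ n → ∃[ x ] (1 ≤ x × x ≤ n × residue n (u * x) ≡ k)
  residue-*-surjective {u} n cu k k≥1 k≤n =
    residue n (u′ * k) , proj₁ (residue-range n (u′ * k)) , proj₂ (residue-range n (u′ * k)) , (begin
    residue n (u * residue n (u′ * k)) ≡⟨ residue-cong n (*-congˡ-% u n (residue-% n (u′ * k))) ⟩
    residue n (u * (u′ * k))           ≡⟨ residue-cong n (inverse-cancelˡ u′ u n u′u≡1 k) ⟩
    residue n k                        ≡⟨ residue-id n k k≥1 k≤n ⟩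
    k                                  ∎)
    where
      open ≡.≡-Reasoning
      u′ = proj₁ (mod-inverse u n cu)
      u′u≡1 = ≡.trans (cong (_% n) (NP.*-comm u′ u)) (proj₂ (mod-inverse u n cu))

  residue-*-injective : ∀ {u} n .{{_ : NonZero n}} → Coprime u n →
                        ∀ x y → 1 ≤ x → x ≤ n → 1 ≤ y → y ≤ n → residue n (u * x) ≡ residue n (u * y) → x ≡ y
  residue-*-injective {u} n cu x y x≥1 x≤n y≥1 y≤n σx≡σy = %-injective n x≥1 x≤n y≥1 y≤n (begin
    x % n               ≡⟨ inverse-cancelˡ u u′ n uu′≡1 x ⟨
    (u′ * (u * x)) % n  ≡⟨ *-congˡ-% u′ n (≡.trans (≡.sym (residue-% n (u * x)))
                             (≡.trans (cong (_% n) σx≡σy) (residue-% n (u * y)))) ⟩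
    (u′ * (u * y)) % n  ≡⟨ inverse-cancelˡ u u′ n uu′≡1 y ⟩
    y % n               ∎)
    where
      open ≡.≡-Reasoning
      u′ = proj₁ (mod-inverse u n cu)
      uu′≡1 = proj₂ (mod-inverse u n cu)

  unit-*-%⇔ : ∀ {r x j} e .{{_ : NonZero e}} → Coprime r e → x % e ≡ (r * j) % e →
              (r % e ≡ x % e) ⇔ (1 % e ≡ j % e)
  unit-*-%⇔ {r} {x} {j} e cr x≡rj = mk⇔ forth back
    where
      open ≡.≡-Reasoning
      r′ = proj₁ (mod-inverse r e cr)
      rr′≡1 = proj₂ (mod-inverse r e cr)
      forth : r % e ≡ x % e → 1 % e ≡ j % e
      forth r≡x = begin
        1 % e              ≡⟨ ≡.trans (cong (_% e) (NP.*-comm r′ r)) rr′≡1 ⟨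
        (r′ * r) % e       ≡⟨ *-congˡ-% r′ e (≡.trans r≡x x≡rj) ⟩
        (r′ * (r * j)) % e ≡⟨ inverse-cancelˡ r r′ e rr′≡1 j ⟩
        j % e              ∎
      back : 1 % e ≡ j % e → r % e ≡ x % e
      back 1≡j = begin
        r % e              ≡⟨ cong (_% e) (NP.*-identityʳ r) ⟨
        (r * 1) % e        ≡⟨ *-congˡ-% r e 1≡j ⟩
        (r * j) % e        ≡⟨ x≡rj ⟨
        x % e              ∎

  module Units {c ℓ} (K : Char0Field c ℓ) where
    open Char0Field K hiding (zero) renaming (refl to ≈-refl)
    open FiniteSums K
    open import Relation.Binary.Reasoning.Setoid setoid

    unit : ℕ → ℕ → Carrier
    unit m j = when (does (gcd j m ℕ.≟ 1)) 1ᴷ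

    unit-coprime : ∀ m j → gcd j m ≡ 1 → unit m j ≈ 1ᴷ
    unit-coprime m j cop = when-true 1ᴷ (dec-true (gcd j m ℕ.≟ 1) cop)

    unit-¬coprime : ∀ m j → ¬ (gcd j m ≡ 1) → unit m j ≈ 0ᴷ
    unit-¬coprime m j ¬cop = when-false 1ᴷ (dec-false (gcd j m ℕ.≟ 1) ¬cop)

    unit-cong : ∀ m j k → (Coprime j m ⇔ Coprime k m) → unit m j ≡ unit m k
    unit-cong m j k iff = cong (λ b → when b 1ᴷ) (does-⇔ gcd-iff (gcd j m ℕ.≟ 1) (gcd k m ℕ.≟ 1))
      where
        gcd-iff : (gcd j m ≡ 1) ⇔ (gcd k m ≡ 1)
        gcd-iff = mk⇔ (λ g≡1 → coprime⇒gcd≡1 (Equivalence.to iff (gcd≡1⇒coprime g≡1)))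
                      (λ g≡1 → coprime⇒gcd≡1 (Equivalence.from iff (gcd≡1⇒coprime g≡1)))

    φ≈sumTo-unit : ∀ m → ι (φ m) ≈ sumTo m (unit m)
    φ≈sumTo-unit m = ι-length-filter (λ k → gcd k m ℕ.≟ 1) (range1 m)

    φ-nonZero : ∀ m → 1 ≤ m → ¬ (ι (φ m) ≈ 0ᴷ)
    φ-nonZero m m≥1 = ι-nonZero (φ m) (nonEmpty (∈-filter⁺ (λ k → gcd k m ℕ.≟ 1) (∈-range1 m NP.≤-refl m≥1)
                                                          (coprime⇒gcd≡1 (1-coprimeTo m))))
      where
        nonEmpty : ∀ {xs : List ℕ} {x} → x ∈ xs → 1 ≤ length xs
        nonEmpty (here _)  = s≤s z≤n
        nonEmpty (there _) = s≤s z≤n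

    sumTo-residue-* : ∀ n .{{_ : NonZero n}} u → Coprime u n → ∀ F →
                      sumTo n (λ j → F (residue n (u * j))) ≈ sumTo n F
    sumTo-residue-* n u cu F = sumTo-bijection n (λ j → residue n (u * j)) F (λ x _ _ → residue-range n (u * x))
                                 (residue-*-surjective n cu) (residue-*-injective n cu)

    unitsIn : ℕ → (e : ℕ) → .{{NonZero e}} → ℕ → Carrier
    unitsIn n e r = sumTo n (λ j → when (does (r % e ℕ.≟ j % e)) (unit n j))

    unitsIn-invariant : ∀ n e .{{_ : NonZero n}} .{{_ : NonZero e}} → e ∣ n →
                        ∀ r → Coprime r e → unitsIn n e r ≈ unitsIn n e 1
    unitsIn-invariant n e e∣n r cr = begin
      sumTo n (G r)                               ≈⟨ sumTo-residue-* n u cu (G r) ⟨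
      sumTo n (λ j → G r (residue n (u * j)))     ≈⟨ sumK-cong (range1 n) shift ⟩
      sumTo n (G 1)                               ∎
      where
        G = λ r j → when (does (r % e ℕ.≟ j % e)) (unit n j)
        t = proj₁ (coprime-representative e n r cr (ℕ.>-nonZero⁻¹ n))
        u = r + e * t
        cu : Coprime u n
        cu = proj₂ (coprime-representative e n r cr (ℕ.>-nonZero⁻¹ n))
        σ%e : ∀ j → residue n (u * j) % e ≡ (r * j) % e
        σ%e j = ≡.trans (residue-%-∣ n (u * j) e∣n) (*-congʳ-% j e (+-*-% r e t))
        shift : ∀ j → G r (residue n (u * j)) ≈ G 1 j
        shift j = when-cong (does-⇔ (unit-*-%⇔ e cr (σ%e j)) (r % e ℕ.≟ residue n (u * j) % e) (1 % e ℕ.≟ j % e))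
                            (λ _ → reflexive (unit-cong n (residue n (u * j)) j (coprime-residue-* n j cu)))

    units≡1 : ℕ → ℕ → Carrier
    units≡1 n e = sumTo n (λ j → when (does (e ∣? (j ∸ 1))) (unit n j))

    unitsIn-1 : ∀ n e .{{_ : NonZero e}} → unitsIn n e 1 ≈ units≡1 n e
    unitsIn-1 n e = sumTo-cong n (λ j j≥1 _ →
      when-cong (does-⇔ (mk⇔ (λ 1≡j → %≡1⇒∣∸1 e j (≡.sym 1≡j))
                             (λ e∣ → ≡.sym (∣∸1⇒%≡1 e j j≥1 e∣)))
                        (1 % e ℕ.≟ j % e) (e ∣? (j ∸ 1)))
                (λ _ → ≈-refl))

    -- Each unit modulo n reduces to exactly one unit modulo e, and every unit
    -- modulo e has the same number of preimages.
    φ-fibres : ∀ n e .{{_ : NonZero n}} .{{_ : NonZero e}} → e ∣ n → ι (φ n) ≈ (ι (φ e) *ᴷ units≡1 n e)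
    φ-fibres n e e∣n = begin
      ι (φ n)                                  ≈⟨ φ≈sumTo-unit n ⟩
      sumTo n (unit n)                         ≈⟨ sumTo-cong n fibre ⟩
      sumTo n (λ j → sumTo e (W j))            ≈⟨ sumK-comm (range1 n) (range1 e) W ⟩
      sumTo e (λ r → sumTo n (λ j → W j r))    ≈⟨ sumK-cong (range1 e) regroup ⟩
      sumTo e (λ r → when ([r⊥e] r) (unitsIn n e r))  ≈⟨ sumK-cong (range1 e) invariant ⟩
      sumTo e (λ r → when ([r⊥e] r) (unitsIn n e 1))  ≈⟨ sumK-cong (range1 e) (λ r → when-1* ([r⊥e] r) (unitsIn n e 1)) ⟩
      sumTo e (λ r → unit e r *ᴷ unitsIn n e 1)       ≈⟨ sumK-*ʳ (range1 e) _ (unit e) ⟨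
      sumTo e (unit e) *ᴷ unitsIn n e 1               ≈⟨ *-cong (sym (φ≈sumTo-unit e)) (unitsIn-1 n e) ⟩
      ι (φ e) *ᴷ units≡1 n e                          ∎
      where
        [r⊥e] = λ r → does (gcd r e ℕ.≟ 1)
        [r≡j] = λ r j → does (r % e ℕ.≟ j % e)
        W : ℕ → ℕ → Carrier
        W j r = when ([r≡j] r j) (when ([r⊥e] r) (unit n j))
        regroup : ∀ r → sumTo n (λ j → W j r) ≈ when ([r⊥e] r) (unitsIn n e r)
        regroup r = trans (sumK-cong (range1 n) (λ j → when-swap ([r≡j] r j) ([r⊥e] r) (unit n j)))
                          (sym (sumK-when ([r⊥e] r) (range1 n) (λ j → when ([r≡j] r j) (unit n j))))
        invariant : ∀ r → when ([r⊥e] r) (unitsIn n e r) ≈ when ([r⊥e] r) (unitsIn n e 1)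
        invariant r = when-cong refl (λ r⊥e → unitsIn-invariant n e e∣n r (gcd≡1⇒coprime (does⇒ (gcd r e ℕ.≟ 1) r⊥e)))
        fibre : ∀ j → 1 ≤ j → j ≤ n → unit n j ≈ sumTo e (W j)
        fibre j _ _ = by-cases (gcd j n ℕ.≟ 1)
          where
            by-cases : Dec (gcd j n ≡ 1) → unit n j ≈ sumTo e (W j)
            by-cases (no ¬cop) = trans (unit-¬coprime n j ¬cop) (sym (sumTo-0 e (λ r _ _ →
              when-zero (does (r % e ℕ.≟ j % e)) (when-zero (does (gcd r e ℕ.≟ 1)) (unit-¬coprime n j ¬cop)))))
            by-cases (yes cop) = sym (trans
              (sumTo-single e _ _ r₀ (proj₁ (residue-range e j)) (proj₂ (residue-range e j))
                            (dec-true (r₀ % e ℕ.≟ j % e) (residue-% e j))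
                            (λ r r≥1 r≤e r≡j → ≡.trans (≡.sym (residue-id e r r≥1 r≤e))
                                                       (residue-cong e (does⇒ (r % e ℕ.≟ j % e) r≡j))))
              (when-true _ (dec-true (gcd r₀ e ℕ.≟ 1) (coprime⇒gcd≡1 r₀-coprime))))
              where
                r₀ = residue e j
                r₀-coprime : Coprime r₀ e
                r₀-coprime = coprime-%-cong e (≡.sym (residue-% e j)) (coprime-∣ʳ e∣n (gcd≡1⇒coprime cop))

module Characters where

  open Arithmetic
  open Sums
  open Totient
  open import Data.Nat as ℕ using (ℕ; zero; suc; _+_; _*_; _∸_; _%_; _/_; _≤_; z≤n; s≤s; NonZero)
  import Data.Nat.Properties as NP
  open import Data.Nat.Divisibility
  open import Data.Nat.DivMod using (m≡m%n+[m/n]*n; [m+kn]%n≡m%n; m∣n⇒o%n%m≡o%m)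
  open import Data.Nat.GCD using (gcd; gcd[m,n]∣m; gcd[m,n]∣n; gcd[m,n]≡0⇒m≡0; gcd-GCD; gcd-identityˡ; module Bézout)
  open import Data.Nat.Coprimality as Coprime using (Coprime; coprime⇒gcd≡1; gcd≡1⇒coprime)
  open import Data.Nat.Tactic.RingSolver using (solve-∀)
  open import Data.Product using (_×_; _,_; proj₁; proj₂; ∃-syntax)
  open import Relation.Nullary using (¬_; Dec; yes; no; does)
  open import Relation.Nullary.Decidable using (does-⇔)
  open import Relation.Binary.PropositionalEquality as ≡ using (_≡_; refl; cong)
  open import Function using (_∘_)
  open import Function.Bundles using (mk⇔; Equivalence)

  private
    identity₁ : ∀ D E s′ t → 1 + D * s′ + D * E * t ≡ 1 + D * (s′ + E * t)
    identity₁ = solve-∀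
    identity₂ : ∀ a E s D t → a + E * s + D * E * t ≡ a + (s + D * t) * E
    identity₂ = solve-∀
    identity₃ : ∀ k g x m → suc (k * g) + m * (x * k) ≡ 1 + k * (g + x * m)
    identity₃ = solve-∀
    identity₄ : ∀ k y e → 1 + k * (y * e) ≡ 1 + e * (y * k)
    identity₄ = solve-∀

  bézout-shift : ∀ k g x m y e → g + x * m ≡ y * e → suc (k * g) + m * (x * k) ≡ 1 + e * (y * k)
  bézout-shift k g x m y e eq = ≡.trans (identity₃ k g x m) (≡.trans (cong (λ z → 1 + k * z) eq) (identity₄ k y e))

  -- x₀ = a + E s is ≡ 1 (mod D) and ≡ a (mod E), hence coprime to D E, and a
  -- representative x₀ + D E t coprime to n keeps both congruences.
  unit-≡1-≡a : ∀ D E n .{{_ : NonZero E}} .{{_ : NonZero n}} → E ∣ n →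
               ∀ a s s′ → Coprime a n → a + E * s ≡ 1 + D * s′ →
               ∃[ x ] (Coprime x n × D ∣ x ∸ 1 × x % E ≡ a % E)
  unit-≡1-≡a D E n E∣n a s s′ ca a+Es≡ = x , proj₂ lift , D∣x∸1 , x≡a
    where
      x₀ = a + E * s
      x₀-coprime-D : Coprime x₀ D
      x₀-coprime-D {c} (c∣x₀ , c∣D) =
        ∣1⇒≡1 (∣m+n∣m⇒∣n (≡.subst (c ∣_) (≡.trans a+Es≡ (NP.+-comm 1 (D * s′))) c∣x₀) (∣-trans c∣D (m∣m*n s′)))
      x₀-coprime-E : Coprime x₀ E
      x₀-coprime-E {c} (c∣x₀ , c∣E) =
        ca (∣m+n∣m⇒∣n (≡.subst (c ∣_) (NP.+-comm a (E * s)) c∣x₀) (∣-trans c∣E (m∣m*n s)) , ∣-trans c∣E E∣n)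
      lift = coprime-representative (D * E) n x₀
               (Coprime.sym (coprime-*ˡ (Coprime.sym x₀-coprime-D) (Coprime.sym x₀-coprime-E))) (ℕ.>-nonZero⁻¹ n)
      t = proj₁ lift
      x = x₀ + D * E * t
      D∣x∸1 : D ∣ x ∸ 1
      D∣x∸1 = ≡.subst (λ z → D ∣ z ∸ 1) (≡.sym (≡.trans (cong (_+ D * E * t) a+Es≡) (identity₁ D E s′ t)))
                      (m∣m*n (s′ + E * t))
      x≡a : x % E ≡ a % E
      x≡a = ≡.trans (cong (_% E) (identity₂ a E s D t)) ([m+kn]%n≡m%n a (s + D * t) E)

  inverse-%-∣ : ∀ {a x x′} E n .{{_ : NonZero E}} .{{_ : NonZero n}} → E ∣ n →
                x % E ≡ a % E → (x * x′) % n ≡ 1 % n → (a * x′) % E ≡ 1 % E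
  inverse-%-∣ {a} {x} {x′} E n E∣n x≡a xx′≡1 = begin
    (a * x′) % E        ≡⟨ *-congʳ-% x′ E x≡a ⟨
    (x * x′) % E        ≡⟨ m∣n⇒o%n%m≡o%m E n (x * x′) E∣n ⟨
    (x * x′) % n % E    ≡⟨ cong (_% E) xx′≡1 ⟩
    1 % n % E           ≡⟨ m∣n⇒o%n%m≡o%m E n 1 E∣n ⟩
    1 % E               ∎
    where open ≡.≡-Reasoning

  module DirichletCharacter {c ℓ} (K : Char0Field c ℓ) (n′ : ℕ) (χ : ℕ → Char0Field.Carrier K)
                            (isχ : IsDirichletChar K (suc n′) χ) where
    open Char0Field K hiding (zero) renaming (refl to ≈-refl)
    open FiniteSums K
    open Units K
    open IsDirichletChar isχ
    open import Relation.Binary.Reasoning.Setoid setoid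
    open import Algebra.Properties.Ring ring using (x∙y⁻¹≈ε⇒x≈y; x≈y⇒x∙y⁻¹≈ε; x[y-z]≈xy-xz)

    n : ℕ
    n = suc n′

    χ-+* : ∀ x q → χ (x + q * n) ≈ χ x
    χ-+* x zero    = reflexive (cong χ (NP.+-identityʳ x))
    χ-+* x (suc q) = trans (reflexive (cong χ (≡.trans (cong (x +_) (NP.+-comm n (q * n))) (≡.sym (NP.+-assoc x (q * n) n)))))
                           (trans (periodic _) (χ-+* x q))

    χ-cong-% : ∀ {a b} → a % n ≡ b % n → χ a ≈ χ b
    χ-cong-% {a} {b} a≡b = begin
      χ a                   ≈⟨ reflexive (cong χ (m≡m%n+[m/n]*n a n)) ⟩
      χ (a % n + a / n * n) ≈⟨ χ-+* (a % n) (a / n) ⟩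
      χ (a % n)             ≡⟨ cong χ a≡b ⟩
      χ (b % n)             ≈⟨ χ-+* (b % n) (b / n) ⟨
      χ (b % n + b / n * n) ≈⟨ reflexive (cong χ (m≡m%n+[m/n]*n b n)) ⟨
      χ b                   ∎

    χ-¬coprime : ∀ a → ¬ (gcd a n ≡ 1) → χ a ≈ 0ᴷ
    χ-¬coprime a = Equivalence.from (zero⇔ a)

    sumχ≡1 : ℕ → Carrier
    sumχ≡1 e = sumTo n (λ j → when (does (e ∣? (j ∸ 1))) (χ j))

    sumχ≡1-induced : ∀ d e → InducedMod K n χ d → d ∣ e → sumχ≡1 e ≈ units≡1 n e
    sumχ≡1-induced d e induced d∣e =
      sumTo-cong n (λ j _ _ → when-cong refl (λ e∣ → by-cases j (does⇒ (e ∣? (j ∸ 1)) e∣) (gcd j n ℕ.≟ 1)))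
      where
        by-cases : ∀ j → e ∣ j ∸ 1 → Dec (gcd j n ≡ 1) → χ j ≈ unit n j
        by-cases j e∣ (yes cop) = trans (induced j cop (∣-trans d∣e e∣)) (sym (unit-coprime n j cop))
        by-cases j e∣ (no ¬cop) = trans (χ-¬coprime j ¬cop) (sym (unit-¬coprime n j ¬cop))

    -- For x as in unit-≡1-≡a and x′ its inverse modulo n, χ(a) = χ(a x′) χ(x) = 1 · 1.
    induced-+* : ∀ D E → 1 ≤ E → E ∣ n → InducedMod K n χ D → InducedMod K n χ E →
                 ∀ a s s′ → gcd a n ≡ 1 → a + E * s ≡ 1 + D * s′ → χ a ≈ 1ᴷ
    induced-+* D E E≥1 E∣n induced-D induced-E a s s′ a-unit a+Es≡ with unit-≡1-≡a D E n E∣n a s s′ ca a+Es≡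
      where instance _ = ℕ.>-nonZero E≥1
            ca = gcd≡1⇒coprime a-unit
    ... | x , cx , D∣x∸1 , x≡a = begin
      χ a                      ≈⟨ *-identityʳ _ ⟨
      χ a *ᴷ 1ᴷ                ≈⟨ *-cong ≈-refl (trans (sym (mult x x′)) (trans (χ-cong-% xx′≡1) one)) ⟨
      χ a *ᴷ (χ x *ᴷ χ x′)     ≈⟨ *-cong ≈-refl (*-comm _ _) ⟩
      χ a *ᴷ (χ x′ *ᴷ χ x)     ≈⟨ *-assoc _ _ _ ⟨
      (χ a *ᴷ χ x′) *ᴷ χ x     ≈⟨ *-cong (sym (mult a x′)) (induced-D x (coprime⇒gcd≡1 cx) D∣x∸1) ⟩
      χ (a * x′) *ᴷ 1ᴷ         ≈⟨ *-identityʳ _ ⟩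
      χ (a * x′)               ≈⟨ induced-E (a * x′) ax′-unit (%≡1⇒∣∸1 E (a * x′) ax′≡1) ⟩
      1ᴷ                       ∎
      where
        instance
          E-nonZero : NonZero E
          E-nonZero = ℕ.>-nonZero E≥1
        x′ = proj₁ (mod-inverse x n cx)
        xx′≡1 = proj₂ (mod-inverse x n cx)
        ax′-unit : gcd (a * x′) n ≡ 1
        ax′-unit = coprime⇒gcd≡1 (coprime-*ˡ {a} (gcd≡1⇒coprime {a} a-unit) (inverse-coprime x n xx′≡1))
        ax′≡1 = inverse-%-∣ E n E∣n x≡a xx′≡1

    induced-gcd : ∀ d e → 1 ≤ d → 1 ≤ e → d ∣ n → e ∣ n →
                  InducedMod K n χ d → InducedMod K n χ e → InducedMod K n χ (gcd d e)
    induced-gcd d e d≥1 e≥1 d∣n e∣n induced-d induced-e zero a-unit _ = induced-d zero a-unit (d ∣0)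
    induced-gcd d e d≥1 e≥1 d∣n e∣n induced-d induced-e (suc a) a-unit (divides k refl)
      with Bézout.identity (gcd-GCD d e)
    ... | Bézout.+- x y eq = induced-+* d e e≥1 e∣n induced-d induced-e (suc a) (y * k) (x * k) a-unit
            (bézout-shift k (gcd d e) y e x d eq)
    ... | Bézout.-+ x y eq = induced-+* e d d≥1 d∣n induced-e induced-d (suc a) (x * k) (y * k) a-unit
            (bézout-shift k (gcd d e) x d y e eq)

    conductor-∣ : ∀ d → IsConductor K n χ d → ∀ e → 1 ≤ e → e ∣ n → InducedMod K n χ e → d ∣ e
    conductor-∣ d (d≥1 , d∣n , induced-d , minimal) e e≥1 e∣n induced-e = ≡.subst (_∣ e) g≡d (gcd[m,n]∣n d e)
      where
        g = gcd d e
        g∣d = gcd[m,n]∣m d e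
        g≥1 : 1 ≤ g
        g≥1 = NP.n≢0⇒n>0 (λ g≡0 → NP.<⇒≢ d≥1 (≡.sym (gcd[m,n]≡0⇒m≡0 g≡0)))
        g≡d : g ≡ d
        g≡d = NP.≤-antisym (∣⇒≤ {{ℕ.>-nonZero d≥1}} g∣d)
                           (minimal g g≥1 (∣-trans g∣d d∣n) (induced-gcd d e d≥1 e≥1 d∣n e∣n induced-d induced-e))

    ∣∸1⇒%≡1-unit : ∀ e .{{_ : NonZero e}} → e ∣ n → ∀ b → gcd b n ≡ 1 → e ∣ b ∸ 1 → b % e ≡ 1 % e
    ∣∸1⇒%≡1-unit e e∣n zero    gcd≡1 _  =
      modulus≡1 e (∣1⇒≡1 (≡.subst (e ∣_) (≡.trans (≡.sym (gcd-identityˡ n)) gcd≡1) e∣n))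
      where modulus≡1 : ∀ m .{{_ : NonZero m}} → m ≡ 1 → 0 % m ≡ 1 % m
            modulus≡1 .1 refl = refl
    ∣∸1⇒%≡1-unit e e∣n (suc b) _     e∣ = ∣∸1⇒%≡1 e (suc b) (s≤s z≤n) e∣

    sumχ≡1-rotate : ∀ e .{{_ : NonZero e}} → e ∣ n → ∀ b → gcd b n ≡ 1 → e ∣ b ∸ 1 →
                    (χ b *ᴷ sumχ≡1 e) ≈ sumχ≡1 e
    sumχ≡1-rotate e e∣n b b-unit e∣b∸1 = sym (begin
      sumTo n G                             ≈⟨ sumTo-residue-* n b (gcd≡1⇒coprime b-unit) G ⟨
      sumTo n (λ j → G (residue n (b * j))) ≈⟨ sumTo-cong n shift ⟩
      sumTo n (λ j → χ b *ᴷ G j)            ≈⟨ sumK-*ˡ (range1 n) (χ b) G ⟨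
      χ b *ᴷ sumTo n G                      ∎)
      where
        G = λ j → when (does (e ∣? (j ∸ 1))) (χ j)
        shift : ∀ j → 1 ≤ j → j ≤ n → G (residue n (b * j)) ≈ (χ b *ᴷ G j)
        shift j j≥1 _ = trans (when-cong (does-⇔ (mk⇔ forth back) (e ∣? (σj ∸ 1)) (e ∣? (j ∸ 1)))
                                         (λ _ → trans (χ-cong-% (residue-% n (b * j))) (mult b j)))
                              (sym (when-*ˡ (does (e ∣? (j ∸ 1))) (χ j) (χ b)))
          where
            σj = residue n (b * j)
            σj≡j : σj % e ≡ j % e
            σj≡j = ≡.trans (residue-%-∣ n (b * j) e∣n)
                     (≡.trans (*-congʳ-% j e (∣∸1⇒%≡1-unit e e∣n b b-unit e∣b∸1)) (cong (_% e) (NP.*-identityˡ j)))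
            forth = ∣∸1-%-cong e (proj₁ (residue-range n (b * j))) σj≡j
            back  = ∣∸1-%-cong e j≥1 (≡.sym σj≡j)

    sumχ≡1-square : ∀ e .{{_ : NonZero e}} → e ∣ n → (sumχ≡1 e *ᴷ sumχ≡1 e) ≈ (units≡1 n e *ᴷ sumχ≡1 e)
    sumχ≡1-square e e∣n = begin
      S *ᴷ S                                                       ≈⟨ sumK-*ʳ (range1 n) S G ⟩
      sumTo n (λ b → G b *ᴷ S)                                     ≈⟨ sumK-cong (range1 n) χ→unit ⟩
      sumTo n (λ b → when (does (e ∣? (b ∸ 1))) (unit n b) *ᴷ S)   ≈⟨ sumK-*ʳ (range1 n) S _ ⟨
      units≡1 n e *ᴷ S                                             ∎
      where
        S = sumχ≡1 e
        G = λ j → when (does (e ∣? (j ∸ 1))) (χ j)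
        χS≈unitS : ∀ b → Dec (gcd b n ≡ 1) → e ∣ b ∸ 1 → (χ b *ᴷ S) ≈ (unit n b *ᴷ S)
        χS≈unitS b (yes b-unit) e∣b∸1 = trans (sumχ≡1-rotate e e∣n b b-unit e∣b∸1)
                                              (sym (trans (*-cong (unit-coprime n b b-unit) ≈-refl) (*-identityˡ S)))
        χS≈unitS b (no ¬b-unit) _     = *-cong (trans (χ-¬coprime b ¬b-unit) (sym (unit-¬coprime n b ¬b-unit))) ≈-refl
        χ→unit : ∀ b → (G b *ᴷ S) ≈ (when (does (e ∣? (b ∸ 1))) (unit n b) *ᴷ S)
        χ→unit b = begin
          when (does (e ∣? (b ∸ 1))) (χ b) *ᴷ S       ≈⟨ when-*ʳ (does (e ∣? (b ∸ 1))) (χ b) S ⟩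
          when (does (e ∣? (b ∸ 1))) (χ b *ᴷ S)       ≈⟨ when-cong refl (χS≈unitS b (gcd b n ℕ.≟ 1) ∘ does⇒ (e ∣? _)) ⟩
          when (does (e ∣? (b ∸ 1))) (unit n b *ᴷ S)  ≈⟨ when-*ʳ (does (e ∣? (b ∸ 1))) (unit n b) S ⟨
          when (does (e ∣? (b ∸ 1))) (unit n b) *ᴷ S  ∎

    sumχ≡1≈units⇒induced : ∀ e .{{_ : NonZero e}} → e ∣ n → sumχ≡1 e ≈ units≡1 n e → InducedMod K n χ e
    sumχ≡1≈units⇒induced e e∣n S≈N b b-unit e∣b∸1 = x∙y⁻¹≈ε⇒x≈y (χ b) 1ᴷ (*-cancelˡ-0 S _ S≉0 (begin
      S *ᴷ (χ b - 1ᴷ)        ≈⟨ x[y-z]≈xy-xz S (χ b) 1ᴷ ⟩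
      S *ᴷ χ b - S *ᴷ 1ᴷ     ≈⟨ x≈y⇒x∙y⁻¹≈ε Sχb≈S1 ⟩
      0ᴷ                     ∎))
      where
        S = sumχ≡1 e
        Sχb≈S1 = trans (*-comm S (χ b)) (trans (sumχ≡1-rotate e e∣n b b-unit e∣b∸1) (sym (*-identityʳ S)))
        S≉0 : ¬ (S ≈ 0ᴷ)
        S≉0 S≈0 = φ-nonZero n (s≤s z≤n) (begin
          ι (φ n)                  ≈⟨ φ-fibres n e e∣n ⟩
          ι (φ e) *ᴷ units≡1 n e   ≈⟨ *-cong ≈-refl (trans (sym S≈N) S≈0) ⟩
          ι (φ e) *ᴷ 0ᴷ            ≈⟨ zeroʳ _ ⟩
          0ᴷ                       ∎)

    -- K has no decidable equality, so instead of splitting on whether S vanishes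
    -- we use S (S - N) = 0 and that S = N would make d ∣ e.
    sumχ≡1-vanishes : ∀ d → IsConductor K n χ d → ∀ e → 1 ≤ e → e ∣ n → ¬ (d ∣ e) → sumχ≡1 e ≈ 0ᴷ
    sumχ≡1-vanishes d conductor e e≥1 e∣n d∤e = *-cancelˡ-0 (S - N) S S-N≉0 (begin
      (S - N) *ᴷ S           ≈⟨ *-comm _ _ ⟩
      S *ᴷ (S - N)           ≈⟨ x[y-z]≈xy-xz S S N ⟩
      S *ᴷ S - S *ᴷ N        ≈⟨ x≈y⇒x∙y⁻¹≈ε (trans (sumχ≡1-square e e∣n) (*-comm N S)) ⟩
      0ᴷ                     ∎)
      where
        instance
          e-nonZero : NonZero e
          e-nonZero = ℕ.>-nonZero e≥1
        S = sumχ≡1 e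
        N = units≡1 n e
        S-N≉0 : ¬ ((S - N) ≈ 0ᴷ)
        S-N≉0 S-N≈0 = d∤e (conductor-∣ d conductor e e≥1 e∣n
                             (sumχ≡1≈units⇒induced e e∣n (x∙y⁻¹≈ε⇒x≈y S N S-N≈0)))

module GcdSums where

  open Arithmetic
  open Sums
  open RegularSystems
  open AMobius
  open Totient
  open Characters
  open import Data.Bool using (Bool; true)
  import Data.Bool
  import Data.Bool as Bool
  open import Data.Nat as ℕ using (ℕ; zero; suc; _*_; _∸_; _≤_; _<_; z≤n; s≤s)
  import Data.Nat.Properties as NP
  open import Data.Nat.Divisibility
  open import Data.List using (filter)
  open import Data.Product using (_×_; _,_; proj₁; proj₂)
  open import Data.Empty using (⊥-elim)
  open import Relation.Nullary using (¬_; yes; no; does)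
  open import Relation.Nullary.Decidable using (dec-true; dec-false)
  open import Relation.Binary.PropositionalEquality as ≡ using (_≡_; refl; cong)

  module Evaluation {c ℓ} (K : Char0Field c ℓ) (A : ℕ → ℕ → Bool) (reg : IsRegularSystem A)
                    (μ : ℕ → Char0Field.Carrier K) (isMobius : IsMobiusA K A μ) (f : ℕ → Char0Field.Carrier K)
                    (n′ : ℕ) (χ : ℕ → Char0Field.Carrier K) (isχ : IsDirichletChar K (suc n′) χ) where
    open Char0Field K hiding (zero) renaming (refl to ≈-refl)
    open FiniteSums K
    open Units K
    open RegularSystem A reg
    open IsRegularSystem reg
    open AMobiusInversion K A reg μ isMobius f
    open DirichletCharacter K n′ χ isχ
    open import Relation.Binary.Reasoning.Setoid setoid
    open import Algebra.Properties.CommutativeSemigroup *-commutativeSemigroup using (x∙yz≈y∙xz)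

    n≥1 : 1 ≤ n
    n≥1 = s≤s z≤n

    gcdCharacterSum : Carrier
    gcdCharacterSum = sumTo n (λ j → f (gcdA A (j ∸ 1) n) *ᴷ χ j)

    φ-ratio : ℕ → Carrier
    φ-ratio e = ι (φ n) *ᴷ (ι (φ e) ⁻¹)

    gcdCharacterSum-expand : gcdCharacterSum ≈ sumTo n (λ e → when (A n e) (μ*f e *ᴷ sumχ≡1 e))
    gcdCharacterSum-expand = begin
      gcdCharacterSum                                   ≈⟨ sumK-cong (range1 n) expand ⟩
      sumTo n (λ j → sumTo n (λ e → T j e))             ≈⟨ sumK-comm (range1 n) (range1 n) T ⟩
      sumTo n (λ e → sumTo n (λ j → T j e))             ≈⟨ sumK-cong (range1 n) pull-μ*f ⟩
      sumTo n (λ e → when (A n e) (μ*f e *ᴷ sumχ≡1 e))  ∎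
      where
        [e∣j∸1] = λ e j → does (e ∣? (j ∸ 1))
        T : ℕ → ℕ → Carrier
        T j e = when (A n e) (when ([e∣j∸1] e j) (μ*f e *ᴷ χ j))
        push-χ : ∀ j e → (when (A n e) (when ([e∣j∸1] e j) (μ*f e)) *ᴷ χ j) ≈ T j e
        push-χ j e = trans (when-*ʳ (A n e) _ (χ j)) (when-congʳ (A n e) (when-*ʳ ([e∣j∸1] e j) (μ*f e) (χ j)))
        expand : ∀ j → (f (gcdA A (j ∸ 1) n) *ᴷ χ j) ≈ sumTo n (T j)
        expand j = begin
          f (gcdA A (j ∸ 1) n) *ᴷ χ j                                       ≈⟨ *-cong (f-gcdA n n≥1 (j ∸ 1)) ≈-refl ⟩
          sumTo n (λ e → when (A n e) (when ([e∣j∸1] e j) (μ*f e))) *ᴷ χ j  ≈⟨ sumK-*ʳ (range1 n) (χ j) _ ⟩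
          sumTo n (λ e → when (A n e) (when ([e∣j∸1] e j) (μ*f e)) *ᴷ χ j)  ≈⟨ sumK-cong (range1 n) (push-χ j) ⟩
          sumTo n (T j)                                                     ∎
        pull-μ*f : ∀ e → sumTo n (λ j → T j e) ≈ when (A n e) (μ*f e *ᴷ sumχ≡1 e)
        pull-μ*f e = trans (sym (sumK-when (A n e) (range1 n) _)) (when-congʳ (A n e) (trans
                     (sumK-cong (range1 n) (λ j → sym (when-*ˡ ([e∣j∸1] e j) (χ j) (μ*f e))))
                     (sym (sumK-*ˡ (range1 n) (μ*f e) _))))

    sumχ≡1-value : ∀ d → IsConductor K n χ d → ∀ e → 1 ≤ e → e ∣ n →
                   sumχ≡1 e ≈ when (does (d ∣? e)) (φ-ratio e)
    sumχ≡1-value d conductor e e≥1 e∣n with d ∣? e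
    ... | no d∤e  = sumχ≡1-vanishes d conductor e e≥1 e∣n d∤e
    ... | yes d∣e = begin
      sumχ≡1 e                                  ≈⟨ sumχ≡1-induced d e (proj₁ (proj₂ (proj₂ conductor))) d∣e ⟩
      units≡1 n e                               ≈⟨ *-inverse-cancelʳ (ι (φ e)) _ (φ-nonZero e e≥1) ⟨
      (units≡1 n e *ᴷ ι (φ e)) *ᴷ (ι (φ e) ⁻¹)  ≈⟨ *-cong (trans (*-comm _ _) (sym φn≈)) ≈-refl ⟩
      ι (φ n) *ᴷ (ι (φ e) ⁻¹)                   ∎
      where φn≈ = φ-fibres n e {{_}} {{ℕ.>-nonZero e≥1}} e∣n

    gcdCharacterSum-conductor : ∀ d → IsConductor K n χ d →
      gcdCharacterSum ≈ (ι (φ n) *ᴷ sumK (filter (λ δ → A n (d * δ) Bool.≟ true) (range1 n))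
                                         (λ δ → μ*f (d * δ) *ᴷ (ι (φ (d * δ)) ⁻¹)))
    gcdCharacterSum-conductor d conductor = begin
      gcdCharacterSum                                      ≈⟨ gcdCharacterSum-expand ⟩
      sumTo n (λ e → when (A n e) (μ*f e *ᴷ sumχ≡1 e))     ≈⟨ sumTo-cong n evaluate ⟩
      sumTo n G                                            ≈⟨ sumTo-multiples n d G (proj₁ conductor) off-multiples beyond ⟩
      sumTo n (λ δ → G (d * δ))                            ≈⟨ sumK-cong (range1 n) factor-φ ⟩
      sumTo n (λ δ → ι (φ n) *ᴷ when (A n (d * δ)) (H δ))  ≈⟨ sumK-*ˡ (range1 n) (ι (φ n)) _ ⟨
      ι (φ n) *ᴷ sumTo n (λ δ → when (A n (d * δ)) (H δ))  ≈⟨ *-cong ≈-refl (sumK-filter-≡true _ (range1 n) H) ⟨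
      ι (φ n) *ᴷ sumK (filter (λ δ → A n (d * δ) Bool.≟ true) (range1 n)) H ∎
      where
        G = λ e → when (A n e) (μ*f e *ᴷ when (does (d ∣? e)) (φ-ratio e))
        H = λ δ → μ*f (d * δ) *ᴷ (ι (φ (d * δ)) ⁻¹)
        evaluate : ∀ e → 1 ≤ e → e ≤ n → when (A n e) (μ*f e *ᴷ sumχ≡1 e) ≈ G e
        evaluate e e≥1 _ = when-cong refl (λ e∈ →
          *-cong ≈-refl (sumχ≡1-value d conductor e e≥1 (proj₂ (divisor n e n≥1 e∈))))
        off-multiples : ∀ e → ¬ (d ∣ e) → G e ≈ 0ᴷ
        off-multiples e d∤e = when-zero (A n e) (trans (*-cong ≈-refl (when-false _ (dec-false (d ∣? e) d∤e))) (zeroʳ _))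
        beyond : ∀ e → n < e → G e ≈ 0ᴷ
        beyond e n<e = when-false _ (A-beyond n≥1 n<e)
        factor-φ : ∀ δ → G (d * δ) ≈ (ι (φ n) *ᴷ when (A n (d * δ)) (H δ))
        factor-φ δ = begin
          when (A n (d * δ)) (μ*f (d * δ) *ᴷ when (does (d ∣? (d * δ))) (φ-ratio (d * δ)))
            ≈⟨ when-congʳ (A n (d * δ)) (*-cong ≈-refl (when-true _ (dec-true (d ∣? (d * δ)) (m∣m*n δ)))) ⟩
          when (A n (d * δ)) (μ*f (d * δ) *ᴷ (ι (φ n) *ᴷ (ι (φ (d * δ)) ⁻¹)))
            ≈⟨ when-congʳ (A n (d * δ)) (x∙yz≈y∙xz _ _ _) ⟩
          when (A n (d * δ)) (ι (φ n) *ᴷ H δ)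
            ≈⟨ when-*ˡ (A n (d * δ)) _ (ι (φ n)) ⟨
          ι (φ n) *ᴷ when (A n (d * δ)) (H δ) ∎

    gcdCharacterSum-primitive : IsConductor K n χ n → gcdCharacterSum ≈ μ*f n
    gcdCharacterSum-primitive conductor = begin
      gcdCharacterSum                                      ≈⟨ gcdCharacterSum-conductor n conductor ⟩
      ι (φ n) *ᴷ sumK (filter (λ δ → A n (n * δ) Bool.≟ true) (range1 n)) H
                                                           ≈⟨ *-cong ≈-refl (sumK-filter-≡true _ (range1 n) H) ⟩
      ι (φ n) *ᴷ sumTo n (λ δ → when (A n (n * δ)) (H δ))  ≈⟨ *-cong ≈-refl (sumTo-single n _ H 1 (s≤s z≤n) n≥1 n*1∈ only-1) ⟩
      ι (φ n) *ᴷ H 1                                       ≡⟨ cong (λ m → ι (φ n) *ᴷ (μ*f m *ᴷ (ι (φ m) ⁻¹))) (NP.*-identityʳ n) ⟩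
      ι (φ n) *ᴷ (μ*f n *ᴷ (ι (φ n) ⁻¹))                   ≈⟨ x∙yz≈y∙xz _ _ _ ⟩
      μ*f n *ᴷ (ι (φ n) *ᴷ (ι (φ n) ⁻¹))                   ≈⟨ *-cong ≈-refl (inverseʳ (ι (φ n)) (φ-nonZero n n≥1)) ⟩
      μ*f n *ᴷ 1ᴷ                                          ≈⟨ *-identityʳ (μ*f n) ⟩
      μ*f n                                                ∎
      where
        H = λ δ → μ*f (n * δ) *ᴷ (ι (φ (n * δ)) ⁻¹)
        n*1∈ : A n (n * 1) ≡ true
        n*1∈ = ≡.trans (cong (A n) (NP.*-identityʳ n)) (A-self n n≥1)
        only-1 : ∀ δ → 1 ≤ δ → δ ≤ n → A n (n * δ) ≡ true → δ ≡ 1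
        only-1 (suc zero)    _ _ _    = refl
        only-1 (suc (suc δ)) _ _ n*δ∈ =
          ⊥-elim (NP.<⇒≱ (NP.m<m*n n (suc (suc δ)) (s≤s (s≤s z≤n))) (proj₂ (A-bound n≥1 n*δ∈)))

open GcdSums using (module Evaluation)

theorem9 : ∀ {c ℓ} (K : Char0Field c ℓ) → let open Char0Field K in
    (A : ℕ → ℕ → Bool) → IsRegularSystem A →
    (μA : ℕ → Carrier) → IsMobiusA K A μA →
    (f : ℕ → Carrier) → (n : ℕ) → 1 ≤ n →
    (χ : ℕ → Carrier) → IsDirichletChar K n χ →
    ((d : ℕ) → IsConductor K n χ d →
     sumK (range1 n) (λ j → f (gcdA A (j ∸ 1) n) *ᴷ χ j)
      ≈ (ι (φ n) *ᴷ sumK (filter (λ δ → A n (d * δ) Data.Bool.≟ true) (range1 n))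
          (λ δ → convA K A μA f (d * δ) *ᴷ (ι (φ (d * δ)) ⁻¹))))
    × (IsConductor K n χ n →
       sumK (range1 n) (λ j → f (gcdA A (j ∸ 1) n) *ᴷ χ j) ≈ convA K A μA f n)
theorem9 K A reg μA isMobius f (suc n′) _ χ isχ = gcdCharacterSum-conductor , gcdCharacterSum-primitive
  where open Evaluation K A reg μA isMobius f n′ χ isχ
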